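{- Every bipartite TRVG with respect to the torus on $n$ vertices has at most $2n$ edges. Moreover, this bound is best possible for $n\ge 8$: for every $n\ge 8$ there exists a bipartite TRVG with respect to the torus on $n$ vertices with exactly $2n$ edges.
   Context: The torus is the flat torus obtained from an axis-parallel rectangle in the plane by identifying opposite sides; horizontal and vertical lines in it are closed loops (wrapping around). A graph $G$ is a TRVG with respect to the torus if there is a collection of axis-parallel rectangles in the torus with pairwise disjoint interiors, one rectangle $R_v$ per vertex $v$, such that distinct vertices $u,v$ are adjacent if and only if some horizontal or vertical line (loop) of the torus meets the interiors of both $R_u$ and $R_v$ (other rectangles do not block visibility).
   Formalization: The side lengths of the torus, the corners and sides of the rectangles $R_v$, and the positions of the horizontal and vertical lines are all rational. -}

module Defs where

open import Data.Nat as ℕ using (ℕ; zero; suc)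
open import Data.Integer as ℤ using (ℤ)
open import Data.Rational using (ℚ; 0ℚ; _/_; _<_; _≤_; _+_; _*_)
open import Data.Fin using (Fin; toℕ)
open import Data.Bool using (Bool; true; false)
open import Data.Product using (Σ; ∃; ∃-syntax; _×_; _,_)
open import Data.Sum using (_⊎_)
open import Data.List using (List; map; allFin; concatMap)
open import Data.Nat.ListAction using (sum)
open import Relation.Nullary using (¬_)
open import Relation.Binary.PropositionalEquality using (_≡_; _≢_)
open import Function.Bundles using (_⇔_)

record Graph (n : ℕ) : Set where
  field
    adj    : Fin n → Fin n → Bool
    sym    : ∀ i j → adj i j ≡ adj j i
    irrefl : ∀ i → adj i i ≡ false
open Graph public

b2n : Bool → ℕ
b2n true  = 1
b2n false = 0

pairEdge : ∀ {n} → Graph n → Fin n → Fin n → ℕ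
pairEdge G i j with toℕ i ℕ.<ᵇ toℕ j
... | true  = b2n (adj G i j)
... | false = 0

numEdges : ∀ {n} → Graph n → ℕ
numEdges {n} G = sum (concatMap (λ i → map (pairEdge G i) (allFin n)) (allFin n))

IsBipartite : ∀ {n} → Graph n → Set
IsBipartite {n} G =
  Σ (Fin n → Bool) λ c → ∀ (i j : Fin n) → adj G i j ≡ true → c i ≢ c j

-- The flat torus  ℝ/Wℤ × ℝ/Hℤ  (coordinates taken rational)

-- t lies in the open arc of length w starting at a on the circle ℝ/Lℤ
InArc : (L a w t : ℚ) → Set
InArc L a w t = Σ ℤ λ k → (a < t + (k / 1) * L) × (t + (k / 1) * L < a + w)

record Rect (W H : ℚ) : Set where
  field
    x y w h : ℚ
    w-pos : 0ℚ < w
    h-pos : 0ℚ < h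
    w≤W   : w ≤ W
    h≤H   : h ≤ H
open Rect public

InInterior : ∀ {W H} → Rect W H → ℚ → ℚ → Set
InInterior {W} {H} R p q = InArc W (x R) (w R) p × InArc H (y R) (h R) q

-- horizontal loop at height c meets the interior of R
HMeets : ∀ {W H} → Rect W H → ℚ → Set
HMeets {W} {H} R c = InArc H (y R) (h R) c

-- vertical loop at abscissa c meets the interior of R
VMeets : ∀ {W H} → Rect W H → ℚ → Set
VMeets {W} {H} R c = InArc W (x R) (w R) c

Sees : ∀ {W H} → Rect W H → Rect W H → Set
Sees R S = (Σ ℚ λ c → HMeets R c × HMeets S c) ⊎ (Σ ℚ λ c → VMeets R c × VMeets S c)

IsTRVG : ∀ {n} → Graph n → Set
IsTRVG {n} G =
  Σ ℚ λ W → Σ ℚ λ H → (0ℚ < W) × (0ℚ < H) ×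
    (Σ (Fin n → Rect W H) λ R → (∀ (i j : Fin n) → i ≢ j →
               ¬ (Σ ℚ λ p → Σ ℚ λ q → InInterior (R i) p q × InInterior (R j) p q))
          × (∀ (i j : Fin n) → i ≢ j → (adj G i j ≡ true ⇔ Sees (R i) (R j))))

module Submission where

-- Of two overlapping arcs of a circle, one contains the starting point of the other.
-- Charge each edge uv, seen along some direction, to the endpoint whose arc starts inside the arc
-- of the other endpoint.  A vertex v is charged at most once per direction: if the arcs of two
-- neighbours u, u′ both contain the starting point of the arc of v, they overlap, so u and u′ see
-- each other although they have the same colour.  With two directions, |E| ≤ 2n.
--
-- Write n = 2p + e with p ≥ 4 and e ≤ 1, and work on the 4p × 4p torus.  Take the
-- 3 × 3 squares a_i with corner (4i + 4, 4i + 12), the 4 × 4 squares b_j with corner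
-- (4j + 2, 4j + 2) and, if e = 1, the unit square c with corner (3, 7).  Then a_i sees exactly
-- b_i, b_{i+1} along vertical loops and b_{i+2}, b_{i+3} along horizontal ones (indices mod p),
-- c sees b_0 and b_1, and no other pair sees each other: 4p + 2e = 2n edges.

module Counting where

  open import Defs hiding (sym)
  open import Data.Bool using (Bool; true; false; not; T)
  open import Data.Empty using (⊥-elim)
  open import Data.Fin as Fin using (Fin; zero; suc; toℕ; _↑ˡ_; _↑ʳ_)
  import Data.Fin.Properties as Finₚ
  open import Data.List using (List; []; _∷_; map; allFin; concatMap; tabulate)
  open import Data.List.Properties using (map-tabulate)
  open import Data.Nat using (ℕ; zero; suc; _+_; _*_; _≤_; z≤n; _<ᵇ_)
  open import Data.Nat.ListAction using (sum)
  open import Data.Nat.ListAction.Properties using (sum-++)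
  open import Data.Nat.Properties
  open import Algebra.Properties.Semiring.Sum +-*-semiring
    using (sum-syntax; ∑-comm; ∑-distrib-+; sum-cong-≗; sum-replicate-zero; *-distribˡ-sum)
  open import Data.Product using (Σ; _,_)
  open import Data.Sum using (_⊎_; inj₁; inj₂)
  open import Data.Unit using (tt)
  open import Function using (_∘_; Injective)
  open import Relation.Binary.Definitions using (tri<; tri≈; tri>)
  open import Relation.Binary.PropositionalEquality
  open import Relation.Nullary using (Dec; does; yes; no)

  does⇒ : ∀ {A : Set} (a? : Dec A) → does a? ≡ true → A
  does⇒ (yes a) _ = a

  ∑-mono-≤ : ∀ {n} {f g : Fin n → ℕ} → (∀ i → f i ≤ g i) → ∑[ i < n ] f i ≤ ∑[ i < n ] g i
  ∑-mono-≤ {zero}  f≤g = z≤n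
  ∑-mono-≤ {suc n} f≤g = +-mono-≤ (f≤g zero) (∑-mono-≤ (f≤g ∘ suc))

  ∑-const : ∀ n c → ∑[ i < n ] c ≡ n * c
  ∑-const zero    c = refl
  ∑-const (suc n) c = cong (c +_) (∑-const n c)

  ∑-point : ∀ {n} (f : Fin n → ℕ) i → f i ≤ ∑[ j < n ] f j
  ∑-point f zero    = m≤m+n _ _
  ∑-point f (suc i) = ≤-trans (∑-point (f ∘ suc) i) (m≤n+m _ (f zero))

  ∑-↑ : ∀ m n (f : Fin (m + n) → ℕ) →
        ∑[ i < m + n ] f i ≡ ∑[ i < m ] f (i ↑ˡ n) + ∑[ j < n ] f (m ↑ʳ j)
  ∑-↑ zero    n f = refl
  ∑-↑ (suc m) n f = trans (cong (f zero +_) (∑-↑ m n (f ∘ suc))) (sym (+-assoc (f zero) _ _))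

  ∑-b2n≤1 : ∀ {n} (P : Fin n → Bool) → (∀ i j → P i ≡ true → P j ≡ true → i ≡ j) →
            ∑[ i < n ] b2n (P i) ≤ 1
  ∑-b2n≤1 {zero}  P unique = z≤n
  ∑-b2n≤1 {suc n} P unique with P zero in P0
  ... | true  = ≤-reflexive (cong suc (n≤0⇒n≡0 (≤-trans (∑-mono-≤ absent) (≤-reflexive (sum-replicate-zero n)))))
    where
    absent : ∀ i → b2n (P (suc i)) ≤ 0
    absent i with P (suc i) in Pi
    ... | true  with () ← unique zero (suc i) P0 Pi
    ... | false = z≤n
  ... | false = ∑-b2n≤1 (P ∘ suc) λ i j Pi Pj → Finₚ.suc-injective (unique (suc i) (suc j) Pi Pj)

  ∑-δ : ∀ {n} (j : Fin n) → ∑[ i < n ] b2n (does (j Fin.≟ i)) ≡ 1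
  ∑-δ {suc n} zero    = cong suc (sum-replicate-zero n)
  ∑-δ {suc n} (suc j) = ∑-δ j

  injection⇒≤∑b2n : ∀ {k n} (P : Fin n → Bool) (g : Fin k → Fin n) → Injective _≡_ _≡_ g →
                    (∀ t → P (g t) ≡ true) → k ≤ ∑[ i < n ] b2n (P i)
  injection⇒≤∑b2n {k} {n} P g g-injective Pg = begin
    k                                                ≡⟨ trans (sym (*-identityʳ k)) (sym (∑-const k 1)) ⟩
    ∑[ t < k ] 1                                     ≡⟨ sum-cong-≗ (λ t → sym (∑-δ (g t))) ⟩
    ∑[ t < k ] ∑[ i < n ] b2n (does (g t Fin.≟ i))   ≡⟨ ∑-comm (λ t i → b2n (does (g t Fin.≟ i))) ⟩
    ∑[ i < n ] ∑[ t < k ] b2n (does (g t Fin.≟ i))   ≤⟨ ∑-mono-≤ hits≤P ⟩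
    ∑[ i < n ] b2n (P i)                             ∎
    where
    open ≤-Reasoning
    hits≤P : ∀ i → ∑[ t < k ] b2n (does (g t Fin.≟ i)) ≤ b2n (P i)
    hits≤P i with P i in Pi
    ... | true  = ∑-b2n≤1 _ λ t t′ gt≡i gt′≡i →
                    g-injective (trans (does⇒ (g t Fin.≟ i) gt≡i) (sym (does⇒ (g t′ Fin.≟ i) gt′≡i)))
    ... | false = ≤-trans (∑-mono-≤ miss) (≤-reflexive (sum-replicate-zero k))
      where
      miss : ∀ t → b2n (does (g t Fin.≟ i)) ≤ 0
      miss t with g t Fin.≟ i
      ... | yes refl with () ← trans (sym (Pg t)) Pi
      ... | no  _    = z≤n

  ∑∑-+-transpose : ∀ {n} (f : Fin n → Fin n → ℕ) →
                   ∑[ i < n ] ∑[ j < n ] (f i j + f j i) ≡ 2 * ∑[ i < n ] ∑[ j < n ] f i j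
  ∑∑-+-transpose {n} f = begin
    ∑[ i < n ] ∑[ j < n ] (f i j + f j i)
      ≡⟨ sum-cong-≗ (λ i → ∑-distrib-+ (f i) (λ j → f j i)) ⟩
    ∑[ i < n ] (∑[ j < n ] f i j + ∑[ j < n ] f j i)
      ≡⟨ ∑-distrib-+ (λ i → ∑[ j < n ] f i j) (λ i → ∑[ j < n ] f j i) ⟩
    F + ∑[ i < n ] ∑[ j < n ] f j i
      ≡⟨ cong (F +_) (∑-comm (λ i j → f j i)) ⟩
    F + F
      ≡⟨ cong (F +_) (sym (+-identityʳ F)) ⟩
    2 * F
      ∎
    where
    open ≡-Reasoning
    F = ∑[ i < n ] ∑[ j < n ] f i j

  sum-tabulate : ∀ {n} (f : Fin n → ℕ) → sum (tabulate f) ≡ ∑[ i < n ] f i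
  sum-tabulate {zero}  f = refl
  sum-tabulate {suc n} f = cong (f zero +_) (sum-tabulate (f ∘ suc))

  sum-map-allFin : ∀ {n} (f : Fin n → ℕ) → sum (map f (allFin n)) ≡ ∑[ i < n ] f i
  sum-map-allFin f = trans (cong sum (map-tabulate (λ i → i) f)) (sum-tabulate f)

  sum-concatMap : ∀ {A : Set} (g : A → List ℕ) (xs : List A) → sum (concatMap g xs) ≡ sum (map (sum ∘ g) xs)
  sum-concatMap g []       = refl
  sum-concatMap g (x ∷ xs) = trans (sum-++ (g x) (concatMap g xs)) (cong (sum (g x) +_) (sum-concatMap g xs))

  module _ {n : ℕ} (G : Graph n) where

    degree : Fin n → ℕ
    degree i = ∑[ j < n ] b2n (adj G i j)

    numEdges≡∑pairEdge : numEdges G ≡ ∑[ i < n ] ∑[ j < n ] pairEdge G i j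
    numEdges≡∑pairEdge = begin
      sum (concatMap row (allFin n))          ≡⟨ sum-concatMap row (allFin n) ⟩
      sum (map (sum ∘ row) (allFin n))        ≡⟨ sum-map-allFin (sum ∘ row) ⟩
      ∑[ i < n ] sum (row i)                  ≡⟨ sum-cong-≗ (λ i → sum-map-allFin (pairEdge G i)) ⟩
      ∑[ i < n ] ∑[ j < n ] pairEdge G i j    ∎
      where
      open ≡-Reasoning
      row : Fin n → List ℕ
      row i = map (pairEdge G i) (allFin n)

    pairEdge-+-transpose : ∀ i j → pairEdge G i j + pairEdge G j i ≡ b2n (adj G i j)
    pairEdge-+-transpose i j with toℕ i <ᵇ toℕ j in i<j | toℕ j <ᵇ toℕ i in j<i
    ... | true  | true  = ⊥-elim (<-asym (<ᵇ⇒< (toℕ i) (toℕ j) (subst T (sym i<j) tt))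
                                        (<ᵇ⇒< (toℕ j) (toℕ i) (subst T (sym j<i) tt)))
    ... | true  | false = +-identityʳ _
    ... | false | true  = cong b2n (sym (Graph.sym G i j))
    ... | false | false with <-cmp (toℕ i) (toℕ j)
    ...   | tri< i<j′ _ _ = ⊥-elim (subst T i<j (<⇒<ᵇ i<j′))
    ...   | tri> _ _ j<i′ = ⊥-elim (subst T j<i (<⇒<ᵇ j<i′))
    ...   | tri≈ _ i≡j _ rewrite Finₚ.toℕ-injective i≡j = cong b2n (sym (irrefl G j))

    handshake : 2 * numEdges G ≡ ∑[ i < n ] degree i
    handshake = begin
      2 * numEdges G                                           ≡⟨ cong (2 *_) numEdges≡∑pairEdge ⟩
      2 * ∑[ i < n ] ∑[ j < n ] pairEdge G i j                 ≡⟨ sym (∑∑-+-transpose (pairEdge G)) ⟩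
      ∑[ i < n ] ∑[ j < n ] (pairEdge G i j + pairEdge G j i)  ≡⟨ sum-cong-≗ (λ i → sum-cong-≗ (pairEdge-+-transpose i)) ⟩
      ∑[ i < n ] degree i                                      ∎
      where open ≡-Reasoning

    numEdges≤∑charge : (c : Fin n → Fin n → ℕ) → (∀ i j → adj G i j ≡ true → 1 ≤ c i j + c j i) →
                       numEdges G ≤ ∑[ i < n ] ∑[ j < n ] c i j
    numEdges≤∑charge c covers = *-cancelˡ-≤ 2 (begin
      2 * numEdges G                          ≡⟨ handshake ⟩
      ∑[ i < n ] ∑[ j < n ] b2n (adj G i j)   ≤⟨ ∑-mono-≤ (λ i → ∑-mono-≤ (edge≤charge i)) ⟩
      ∑[ i < n ] ∑[ j < n ] (c i j + c j i)   ≡⟨ ∑∑-+-transpose c ⟩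
      2 * ∑[ i < n ] ∑[ j < n ] c i j         ∎)
      where
      open ≤-Reasoning
      edge≤charge : ∀ i j → b2n (adj G i j) ≤ c i j + c j i
      edge≤charge i j with adj G i j in e
      ... | true  = covers i j e
      ... | false = z≤n

    numEdges≤k*n : ∀ k (catches : Fin k → Fin n → Fin n → Bool) →
      (∀ i j → adj G i j ≡ true → Σ (Fin k) λ a → catches a j i ≡ true ⊎ catches a i j ≡ true) →
      (∀ a v u u′ → catches a u v ≡ true → catches a u′ v ≡ true → u ≡ u′) →
      numEdges G ≤ k * n
    numEdges≤k*n k catches covered once = begin
      numEdges G
        ≤⟨ numEdges≤∑charge c c-covers ⟩
      ∑[ v < n ] ∑[ u < n ] ∑[ a < k ] b2n (catches a u v)
        ≡⟨ sum-cong-≗ (λ v → ∑-comm (λ u a → b2n (catches a u v))) ⟩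
      ∑[ v < n ] ∑[ a < k ] ∑[ u < n ] b2n (catches a u v)
        ≤⟨ ∑-mono-≤ (λ v → ∑-mono-≤ (λ a → ∑-b2n≤1 _ (λ u u′ → once a v u u′))) ⟩
      ∑[ v < n ] ∑[ a < k ] 1
        ≡⟨ sum-cong-≗ {n} (λ v → trans (∑-const k 1) (*-identityʳ k)) ⟩
      ∑[ v < n ] k
        ≡⟨ trans (∑-const n k) (*-comm n k) ⟩
      k * n
        ∎
      where
      open ≤-Reasoning
      c : Fin n → Fin n → ℕ
      c v u = ∑[ a < k ] b2n (catches a u v)
      caught : ∀ {a u v} → catches a u v ≡ true → 1 ≤ c v u
      caught {a} {u} {v} e = ≤-trans (≤-reflexive (cong b2n (sym e))) (∑-point (λ a → b2n (catches a u v)) a)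
      c-covers : ∀ i j → adj G i j ≡ true → 1 ≤ c i j + c j i
      c-covers i j e with covered i j e
      ... | a , inj₁ j-catches-i = ≤-trans (caught j-catches-i) (m≤m+n _ _)
      ... | a , inj₂ i-catches-j = ≤-trans (caught i-catches-j) (m≤n+m _ _)

    ∑-degree-independent≤numEdges : (s : Fin n → Bool) → (∀ i j → s i ≡ true → s j ≡ true → adj G i j ≡ false) →
                                    ∑[ i < n ] (b2n (s i) * degree i) ≤ numEdges G
    ∑-degree-independent≤numEdges s independent = *-cancelˡ-≤ 2 (begin
      2 * D s                                                          ≡⟨ cong (D s +_) (+-identityʳ (D s)) ⟩
      D s + D s                                                        ≤⟨ +-monoʳ-≤ (D s) Ds≤D¬s ⟩
      D s + D (not ∘ s)                                                ≡⟨ sym (∑-distrib-+ (weighted s) (weighted (not ∘ s))) ⟩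
      ∑[ i < n ] (b2n (s i) * degree i + b2n (not (s i)) * degree i)   ≡⟨ sum-cong-≗ (λ i → split (s i) (degree i)) ⟩
      ∑[ i < n ] degree i                                              ≡⟨ sym handshake ⟩
      2 * numEdges G                                                   ∎)
      where
      open ≤-Reasoning
      weighted : (Fin n → Bool) → Fin n → ℕ
      weighted t i = b2n (t i) * degree i
      D : (Fin n → Bool) → ℕ
      D t = ∑[ i < n ] weighted t i
      split : ∀ b d → b2n b * d + b2n (not b) * d ≡ d
      split true  d = trans (+-identityʳ _) (+-identityʳ d)
      split false d = +-identityʳ d
      crossing : ∀ i j → b2n (s i) * b2n (adj G i j) ≤ b2n (not (s j)) * b2n (adj G j i)
      crossing i j with s i in si | s j in sj | adj G i j in aij
      ... | false | _     | _     = z≤n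
      ... | true  | _     | false = z≤n
      ... | true  | true  | true  with () ← trans (sym aij) (independent i j si sj)
      ... | true  | false | true  rewrite Graph.sym G j i | aij = ≤-refl
      Ds≤D¬s : D s ≤ D (not ∘ s)
      Ds≤D¬s = begin
        D s
          ≡⟨ sum-cong-≗ (λ i → *-distribˡ-sum (b2n (s i)) (λ j → b2n (adj G i j))) ⟩
        ∑[ i < n ] ∑[ j < n ] (b2n (s i) * b2n (adj G i j))
          ≤⟨ ∑-mono-≤ (λ i → ∑-mono-≤ (crossing i)) ⟩
        ∑[ i < n ] ∑[ j < n ] (b2n (not (s j)) * b2n (adj G j i))
          ≡⟨ ∑-comm (λ i j → b2n (not (s j)) * b2n (adj G j i)) ⟩
        ∑[ j < n ] ∑[ i < n ] (b2n (not (s j)) * b2n (adj G j i))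
          ≡⟨ sum-cong-≗ (λ j → sym (*-distribˡ-sum (b2n (not (s j))) (λ i → b2n (adj G j i)))) ⟩
        D (not ∘ s)
          ∎

module Embedding where

  open import Data.Integer as ℤ using (ℤ; +_; -[1+_]; +<+; +≤+)
  import Data.Integer.Properties as ℤₚ
  open import Data.Nat as ℕ using (ℕ; zero; suc)
  open import Data.Nat.Coprimality using (1-coprimeTo; sym)
  open import Data.Rational using (ℚ; mkℚ; *<*; *≤*; _/_; _<_; _≤_; _+_; _*_; _-_; -_)
  open import Data.Rational.Properties using (↥p/↧p≡p; /-cong; neg-distribˡ-*)
  open import Relation.Binary.PropositionalEquality hiding (sym)
  import Relation.Binary.PropositionalEquality as ≡

  fromℤ : ℤ → ℚ
  fromℤ z = mkℚ z 0 (sym (1-coprimeTo _))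

  z/1≡fromℤ : ∀ z → z / 1 ≡ fromℤ z
  z/1≡fromℤ z = ↥p/↧p≡p (fromℤ z)

  fromℤ-homo-+ : ∀ a b → fromℤ (a ℤ.+ b) ≡ fromℤ a + fromℤ b
  fromℤ-homo-+ a b = ≡.sym (trans (/-cong {p₁ = a ℤ.* + 1 ℤ.+ b ℤ.* + 1} {q₁ = 1}
    (cong₂ ℤ._+_ (ℤₚ.*-identityʳ a) (ℤₚ.*-identityʳ b)) refl) (z/1≡fromℤ (a ℤ.+ b)))

  fromℤ-homo‿- : ∀ a → fromℤ (ℤ.- a) ≡ - fromℤ a
  fromℤ-homo‿- (+ zero)  = refl
  fromℤ-homo‿- (+ suc n) = refl
  fromℤ-homo‿- -[1+ n ]  = refl

  fromℤ-homo-* : ∀ a b → fromℤ (a ℤ.* b) ≡ fromℤ a * fromℤ b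
  fromℤ-homo-* a b = ≡.sym (z/1≡fromℤ (a ℤ.* b))

  /1-homo-− : ∀ a b → (a ℤ.- b) / 1 ≡ a / 1 - b / 1
  /1-homo-− a b = begin
    (a ℤ.- b) / 1            ≡⟨ z/1≡fromℤ (a ℤ.- b) ⟩
    fromℤ (a ℤ.- b)          ≡⟨ fromℤ-homo-+ a (ℤ.- b) ⟩
    fromℤ a + fromℤ (ℤ.- b)  ≡⟨ cong (_+_ (fromℤ a)) (fromℤ-homo‿- b) ⟩
    fromℤ a - fromℤ b        ≡⟨ cong₂ _-_ (z/1≡fromℤ a) (z/1≡fromℤ b) ⟨
    a / 1 - b / 1            ∎
    where open ≡-Reasoning

  ⟦_⟧ : ℕ → ℚ
  ⟦ n ⟧ = fromℤ (+ n)

  ⟦⟧-homo-+ : ∀ m n → ⟦ m ℕ.+ n ⟧ ≡ ⟦ m ⟧ + ⟦ n ⟧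
  ⟦⟧-homo-+ m n = fromℤ-homo-+ (+ m) (+ n)

  ⟦⟧-homo-* : ∀ m n → ⟦ m ℕ.* n ⟧ ≡ ⟦ m ⟧ * ⟦ n ⟧
  ⟦⟧-homo-* m n = trans (cong fromℤ (ℤₚ.pos-* m n)) (fromℤ-homo-* (+ m) (+ n))

  ⟦⟧-mono-< : ∀ {m n} → m ℕ.< n → ⟦ m ⟧ < ⟦ n ⟧
  ⟦⟧-mono-< {m} {n} m<n =
    *<* (subst₂ ℤ._<_ (≡.sym (ℤₚ.*-identityʳ (+ m))) (≡.sym (ℤₚ.*-identityʳ (+ n))) (+<+ m<n))

  ⟦⟧-mono-≤ : ∀ {m n} → m ℕ.≤ n → ⟦ m ⟧ ≤ ⟦ n ⟧
  ⟦⟧-mono-≤ {m} {n} m≤n =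
    *≤* (subst₂ ℤ._≤_ (≡.sym (ℤₚ.*-identityʳ (+ m))) (≡.sym (ℤₚ.*-identityʳ (+ n))) (+≤+ m≤n))

  ⟦⟧-cancel-< : ∀ {m n} → ⟦ m ⟧ < ⟦ n ⟧ → m ℕ.< n
  ⟦⟧-cancel-< {m} {n} (*<* m<n) =
    ℤₚ.drop‿+<+ (subst₂ ℤ._<_ (ℤₚ.*-identityʳ (+ m)) (ℤₚ.*-identityʳ (+ n)) m<n)

  +k/1*⟦L⟧ : ∀ k L → (+ k / 1) * ⟦ L ⟧ ≡ ⟦ k ℕ.* L ⟧
  +k/1*⟦L⟧ k L = trans (cong (_* ⟦ L ⟧) (z/1≡fromℤ (+ k))) (≡.sym (⟦⟧-homo-* k L))

  -[1+k]/1*⟦L⟧ : ∀ k L → (-[1+ k ] / 1) * ⟦ L ⟧ ≡ - ⟦ suc k ℕ.* L ⟧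
  -[1+k]/1*⟦L⟧ k L = begin
    (-[1+ k ] / 1) * ⟦ L ⟧   ≡⟨ cong (_* ⟦ L ⟧) (trans (z/1≡fromℤ -[1+ k ]) (fromℤ-homo‿- (+ suc k))) ⟩
    - ⟦ suc k ⟧ * ⟦ L ⟧      ≡⟨ neg-distribˡ-* ⟦ suc k ⟧ ⟦ L ⟧ ⟨
    - (⟦ suc k ⟧ * ⟦ L ⟧)    ≡⟨ cong -_ (⟦⟧-homo-* (suc k) L) ⟨
    - ⟦ suc k ℕ.* L ⟧        ∎
    where open ≡-Reasoning

module CircleArcs where

  open import Defs using (InArc)
  open Embedding using (/1-homo-−)
  open import Data.Integer as ℤ using (ℤ)
  open import Data.Product using (Σ; _×_; _,_)
  open import Data.Rational using (ℚ; 0ℚ; _/_; _<_; _≤_; _+_; _*_; _-_; -_; _⊓_)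
  open import Data.Rational.Properties
  open import Data.Rational.Solver using (module +-*-Solver)
  open import Data.Sum using (_⊎_; inj₁; inj₂)
  open import Relation.Binary.PropositionalEquality
  open import Relation.Nullary using (yes; no)
  open import Algebra.Bundles using (CommutativeMonoid)
  open import Algebra.Properties.CommutativeSemigroup
    (CommutativeMonoid.commutativeSemigroup +-0-commutativeMonoid) using (xy∙z≈xz∙y)
  open +-*-Solver

  InHalfOpenArc : (L a w t : ℚ) → Set
  InHalfOpenArc L a w t = Σ ℤ λ k → (a ≤ t + (k / 1) * L) × (t + (k / 1) * L < a + w)

  Overlap : (L a w b w′ : ℚ) → Set
  Overlap L a w b w′ = Σ ℚ λ c → InArc L a w c × InArc L b w′ c

  Overlap-swap : ∀ {L a w b w′} → Overlap L a w b w′ → Overlap L b w′ a w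
  Overlap-swap (c , c∈a , c∈b) = c , c∈b , c∈a

  shift-frame : ∀ L t k k′ → (t + (k / 1) * L) + ((k′ ℤ.- k) / 1) * L ≡ t + (k′ / 1) * L
  shift-frame L t k k′ rewrite /1-homo-− k′ k =
    solve 4 (λ L t K K′ → (t :+ K :* L) :+ (K′ :- K) :* L := t :+ K′ :* L) refl L t (k / 1) (k′ / 1)

  shift-back : ∀ L t k k′ → (t + ((k ℤ.- k′) / 1) * L) + ((k′ ℤ.- k) / 1) * L ≡ t
  shift-back L t k k′ rewrite /1-homo-− k k′ | /1-homo-− k′ k =
    solve 4 (λ L t K K′ → (t :+ (K :- K′) :* L) :+ (K′ :- K) :* L := t) refl L t (k / 1) (k′ / 1)

  overlap⇒start∈ : ∀ {L a w b w′} → Overlap L a w b w′ → InHalfOpenArc L b w′ a ⊎ InHalfOpenArc L a w b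
  overlap⇒start∈ {L} {a} {w} {b} {w′} (c , (k , a<c₁ , c₁<a+w) , (k′ , b<c₂ , c₂<b+w′))
    with a ≤? b + ((k ℤ.- k′) / 1) * L
  ... | yes a≤b₁ = inj₂ (k ℤ.- k′ , a≤b₁ , (begin-strict
    b + ((k ℤ.- k′) / 1) * L                    <⟨ +-monoˡ-< _ b<c₂ ⟩
    (c + (k′ / 1) * L) + ((k ℤ.- k′) / 1) * L   ≡⟨ shift-frame L c k′ k ⟩
    c + (k / 1) * L                             <⟨ c₁<a+w ⟩
    a + w                                       ∎))
    where open ≤-Reasoning
  ... | no a≰b₁ = inj₁ (k′ ℤ.- k , <⇒≤ b<a₂ , (begin-strict
    a + ((k′ ℤ.- k) / 1) * L                    <⟨ +-monoˡ-< _ a<c₁ ⟩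
    (c + (k / 1) * L) + ((k′ ℤ.- k) / 1) * L    ≡⟨ shift-frame L c k k′ ⟩
    c + (k′ / 1) * L                            <⟨ c₂<b+w′ ⟩
    b + w′                                      ∎))
    where
    open ≤-Reasoning
    b<a₂ : b < a + ((k′ ℤ.- k) / 1) * L
    b<a₂ = begin-strict
      b                                                   ≡⟨ shift-back L b k k′ ⟨
      (b + ((k ℤ.- k′) / 1) * L) + ((k′ ℤ.- k) / 1) * L   <⟨ +-monoˡ-< _ (≰⇒> a≰b₁) ⟩
      a + ((k′ ℤ.- k) / 1) * L                            ∎

  p<q⇒0<q-p : ∀ {s x} → s < x → 0ℚ < x - s
  p<q⇒0<q-p {s} {x} s<x = subst (_< x - s) (+-inverseʳ s) (+-monoˡ-< (- s) s<x)

  0<⊓ : ∀ {g g′} → 0ℚ < g → 0ℚ < g′ → 0ℚ < g ⊓ g′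
  0<⊓ {g} {g′} 0<g 0<g′ with ⊓-sel g g′
  ... | inj₁ g⊓g′≡g  = subst (0ℚ <_) (sym g⊓g′≡g) 0<g
  ... | inj₂ g⊓g′≡g′ = subst (0ℚ <_) (sym g⊓g′≡g′) 0<g′

  nudge : ∀ {b w s r} → b ≤ s → 0ℚ < r → r < (b + w) - s → b < s + r × s + r < b + w
  nudge {b} {w} {s} {r} b≤s 0<r r<gap = b<s+r , s+r<b+w
    where
    open ≤-Reasoning
    b<s+r : b < s + r
    b<s+r = begin-strict b ≡⟨ +-identityʳ b ⟨ b + 0ℚ <⟨ +-mono-≤-< b≤s 0<r ⟩ s + r ∎
    s+r<b+w : s + r < b + w
    s+r<b+w = begin-strict
      s + r              <⟨ +-monoʳ-< s r<gap ⟩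
      s + ((b + w) - s)  ≡⟨ solve 2 (λ s x → s :+ (x :- s) := x) refl s (b + w) ⟩
      b + w              ∎

  start∈-both⇒overlap : ∀ {L b w b′ w′ t} → InHalfOpenArc L b w t → InHalfOpenArc L b′ w′ t → Overlap L b w b′ w′
  start∈-both⇒overlap {L} {b} {w} {b′} {w′} {t} (k , b≤s , s<b+w) (k′ , b′≤s′ , s′<b′+w′)
    with <-dense (0<⊓ (p<q⇒0<q-p s<b+w) (p<q⇒0<q-p s′<b′+w′))
  ... | r , 0<r , r<g⊓g′ =
    t + r , (k , in-shifted k b≤s (<-≤-trans r<g⊓g′ (p⊓q≤p g g′)))
          , (k′ , in-shifted k′ b′≤s′ (<-≤-trans r<g⊓g′ (p⊓q≤q g g′)))
    where
    g  = (b + w) - (t + (k / 1) * L)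
    g′ = (b′ + w′) - (t + (k′ / 1) * L)
    in-shifted : ∀ {β ω} k → β ≤ t + (k / 1) * L → r < (β + ω) - (t + (k / 1) * L) →
                 β < (t + r) + (k / 1) * L × (t + r) + (k / 1) * L < β + ω
    in-shifted {β} {ω} k β≤s r<gap =
      subst (λ x → β < x × x < β + ω) (xy∙z≈xz∙y t ((k / 1) * L) r) (nudge β≤s 0<r r<gap)

module UpperBound where

  open import Defs hiding (sym)
  open Counting using (numEdges≤k*n)
  open CircleArcs
  open import Data.Bool using (Bool; true; false)
  open import Data.Bool.Properties using (¬-not)
  open import Data.Empty using (⊥-elim)
  open import Data.Fin using (Fin; zero; suc; _≟_)
  open import Data.Maybe as Maybe using (Maybe; just; nothing; is-just; _<∣>_)
  open import Data.Nat using (ℕ; _≤_; _*_)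
  open import Data.Product using (Σ; _×_; _,_; proj₁; proj₂)
  open import Data.Rational using (ℚ)
  open import Data.Sum as Sum using (_⊎_; inj₁; inj₂)
  open import Function using (_∘_)
  open import Function.Bundles using (_⇔_; Equivalence)
  open import Relation.Binary.PropositionalEquality
  open import Relation.Nullary using (yes; no)

  Axis : Set
  Axis = Fin 2

  pattern horizontal = zero
  pattern vertical   = suc zero

  module _ {W H : ℚ} where

    period : Axis → ℚ
    period horizontal = H
    period vertical   = W

    start extent : Axis → Rect W H → ℚ
    start horizontal R = y R
    start vertical   R = x R
    extent horizontal R = h R
    extent vertical   R = w R

    SeesAlong : Axis → Rect W H → Rect W H → Set
    SeesAlong a R S = Overlap (period a) (start a R) (extent a R) (start a S) (extent a S)

    StartsIn : Axis → Rect W H → Rect W H → Set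
    StartsIn a R S = InHalfOpenArc (period a) (start a S) (extent a S) (start a R)

    seesAlong⇒sees : ∀ a {R S} → SeesAlong a R S → Sees R S
    seesAlong⇒sees horizontal = inj₁
    seesAlong⇒sees vertical   = inj₂

    landing : ∀ a {R S} → Sees R S → Maybe (StartsIn a R S ⊎ StartsIn a S R)
    landing horizontal (inj₁ o) = just (overlap⇒start∈ o)
    landing vertical   (inj₂ o) = just (overlap⇒start∈ o)
    landing _          _        = nothing

    landing-axis : ∀ {R S} (s : Sees R S) →
                   Σ Axis λ a → Σ (StartsIn a R S ⊎ StartsIn a S R) λ ℓ → landing a s ≡ just ℓ
    landing-axis (inj₁ o) = horizontal , _ , refl
    landing-axis (inj₂ o) = vertical   , _ , refl

  left : ∀ {A B : Set} → Maybe (A ⊎ B) → Maybe A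
  left (just (inj₁ a)) = just a
  left _               = nothing

  right : ∀ {A B : Set} → Maybe (A ⊎ B) → Maybe B
  right (just (inj₂ b)) = just b
  right _               = nothing

  is-just⇒ : ∀ {A : Set} {m : Maybe A} → is-just m ≡ true → A
  is-just⇒ {m = just a} _ = a

  is-just-<∣>ˡ : ∀ {A : Set} (m m′ : Maybe A) → is-just m ≡ true → is-just (m <∣> m′) ≡ true
  is-just-<∣>ˡ (just _) m′ _ = refl

  is-just-<∣>ʳ : ∀ {A : Set} (m m′ : Maybe A) → is-just m′ ≡ true → is-just (m <∣> m′) ≡ true
  is-just-<∣>ʳ (just _) m′ _ = refl
  is-just-<∣>ʳ nothing  m′ e = e

  module _ {n : ℕ} (G : Graph n) (colour : Fin n → Bool) (bipartite : ∀ i j → adj G i j ≡ true → colour i ≢ colour j)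
           {W H : ℚ} (R : Fin n → Rect W H) (visible : ∀ i j → i ≢ j → (adj G i j ≡ true ⇔ Sees (R i) (R j))) where

    sees : ∀ i j → adj G i j ≡ true → Sees (R i) (R j)
    sees i j e = Equivalence.to (visible i j i≢j) e
      where
      i≢j : i ≢ j
      i≢j refl with () ← trans (sym e) (irrefl G i)

    Catches : Axis → Fin n → Fin n → Set
    Catches a u v = adj G u v ≡ true × StartsIn a (R v) (R u)

    Orientation : Axis → Fin n → Fin n → Set
    Orientation a i j = Catches a j i ⊎ Catches a i j

    toOrientation : ∀ {a i j} → adj G i j ≡ true → StartsIn a (R i) (R j) ⊎ StartsIn a (R j) (R i) → Orientation a i j
    toOrientation {i = i} {j} e = Sum.map (trans (Graph.sym G j i) e ,_) (e ,_)

    orientWith : ∀ a i j x → adj G i j ≡ x → Maybe (Orientation a i j)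
    orientWith a i j true  e = Maybe.map (toOrientation {a} e) (landing a (sees i j e))
    orientWith a i j false _ = nothing

    orient : ∀ a i j → Maybe (Orientation a i j)
    orient a i j = orientWith a i j (adj G i j) refl

    orient-edge : ∀ i j → adj G i j ≡ true → Σ Axis λ a → Σ (Orientation a i j) λ o → orient a i j ≡ just o
    orient-edge i j = go (adj G i j) refl
      where
      go : ∀ x (e : adj G i j ≡ x) → x ≡ true → Σ Axis λ a → Σ (Orientation a i j) λ o → orientWith a i j x e ≡ just o
      go true e _ with landing-axis (sees i j e)
      ... | a , ℓ , landed = a , toOrientation {a} e ℓ , cong (Maybe.map (toOrientation {a} e)) landed

    catches : Axis → Fin n → Fin n → Bool
    catches a u v = is-just (left (orient a v u) <∣> right (orient a u v))

    every-edge-caught : ∀ i j → adj G i j ≡ true → Σ Axis λ a → catches a j i ≡ true ⊎ catches a i j ≡ true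
    every-edge-caught i j e with orient-edge i j e
    ... | a , inj₁ _ , oriented = a , inj₁ (is-just-<∣>ˡ (left (orient a i j)) _ (cong (is-just ∘ left) oriented))
    ... | a , inj₂ _ , oriented = a , inj₂ (is-just-<∣>ʳ (left (orient a j i)) _ (cong (is-just ∘ right) oriented))

    caught-at-most-once : ∀ a v u u′ → catches a u v ≡ true → catches a u′ v ≡ true → u ≡ u′
    caught-at-most-once a v u u′ u-catches u′-catches with u ≟ u′
    ... | yes u≡u′ = u≡u′
    ... | no  u≢u′ = ⊥-elim (bipartite u u′ u~u′ (trans (¬-not (bipartite u v u~v)) (sym (¬-not (bipartite u′ v u′~v)))))
      where
      u~v  = proj₁ (is-just⇒ u-catches)
      u′~v = proj₁ (is-just⇒ u′-catches)
      u~u′ : adj G u u′ ≡ true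
      u~u′ = Equivalence.from (visible u u′ u≢u′) (seesAlong⇒sees a
               (start∈-both⇒overlap {t = start a (R v)} (proj₂ (is-just⇒ u-catches)) (proj₂ (is-just⇒ u′-catches))))

    numEdges≤2n : numEdges G ≤ 2 * n
    numEdges≤2n = numEdges≤k*n G 2 catches every-edge-caught caught-at-most-once

module Residues where

  open import Data.Empty using (⊥-elim)
  open import Data.Nat using (ℕ; zero; suc; _+_; _*_; _∸_; _≤_; _<_; NonZero)
  open import Data.Nat.DivMod using (_%_; _/_; m≡m%n+[m/n]*n; [m+kn]%n≡m%n; %-distribˡ-+)
  open import Data.Nat.Properties
  open import Data.Nat.Solver using (module +-*-Solver)
  open import Data.Sum using (_⊎_; inj₁; inj₂)
  open import Function.Bundles using (_⇔_; mk⇔; Equivalence)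
  open import Relation.Binary.PropositionalEquality
  open import Algebra.Properties.CommutativeSemigroup +-commutativeSemigroup using (xy∙z≈xz∙y)
  open +-*-Solver

  data Shifted (R : ℕ → ℕ → Set) (p X Y : ℕ) : Set where
    shiftʳ : ∀ k → R X (Y + k * p) → Shifted R p X Y
    shiftˡ : ∀ k → R (X + k * p) Y → Shifted R p X Y

  Shifted-map : ∀ {R R′ : ℕ → ℕ → Set} {p X Y} → (∀ X Y → R X Y → R′ X Y) → Shifted R p X Y → Shifted R′ p X Y
  Shifted-map f (shiftʳ k r) = shiftʳ k (f _ _ r)
  Shifted-map f (shiftˡ k r) = shiftˡ k (f _ _ r)

  Shifted-cong : ∀ {R R′ : ℕ → ℕ → Set} {p X Y} → (∀ X Y → R X Y ⇔ R′ X Y) → Shifted R p X Y ⇔ Shifted R′ p X Y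
  Shifted-cong R⇔R′ = mk⇔ (Shifted-map (λ X Y → Equivalence.to (R⇔R′ X Y)))
                          (Shifted-map (λ X Y → Equivalence.from (R⇔R′ X Y)))

  Shifted-⊎ : ∀ {R R′ : ℕ → ℕ → Set} {p X Y} →
              Shifted (λ X Y → R X Y ⊎ R′ X Y) p X Y ⇔ (Shifted R p X Y ⊎ Shifted R′ p X Y)
  Shifted-⊎ {R} {R′} {p} {X} {Y} = mk⇔ to from
    where
    to : Shifted (λ X Y → R X Y ⊎ R′ X Y) p X Y → Shifted R p X Y ⊎ Shifted R′ p X Y
    to (shiftʳ k (inj₁ r)) = inj₁ (shiftʳ k r)
    to (shiftʳ k (inj₂ r)) = inj₂ (shiftʳ k r)
    to (shiftˡ k (inj₁ r)) = inj₁ (shiftˡ k r)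
    to (shiftˡ k (inj₂ r)) = inj₂ (shiftˡ k r)
    from : Shifted R p X Y ⊎ Shifted R′ p X Y → Shifted (λ X Y → R X Y ⊎ R′ X Y) p X Y
    from (inj₁ (shiftʳ k r)) = shiftʳ k (inj₁ r)
    from (inj₁ (shiftˡ k r)) = shiftˡ k (inj₁ r)
    from (inj₂ (shiftʳ k r)) = shiftʳ k (inj₂ r)
    from (inj₂ (shiftˡ k r)) = shiftˡ k (inj₂ r)

  Shifted-suc : ∀ {p X Y} → Shifted (λ X Y → X ≡ suc Y) p X Y ⇔ Shifted _≡_ p X (suc Y)
  Shifted-suc = mk⇔ (λ { (shiftʳ k e) → shiftʳ k e ; (shiftˡ k e) → shiftˡ k e })
                    (λ { (shiftʳ k e) → shiftʳ k e ; (shiftˡ k e) → shiftˡ k e })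

  module _ {n : ℕ} {{_ : NonZero n}} where

    %-≡⇒shift : ∀ {x y} → x % n ≡ y % n → y / n ≤ x / n → x ≡ y + (x / n ∸ y / n) * n
    %-≡⇒shift {x} {y} x≡y y/n≤x/n = begin
      x                                          ≡⟨ m≡m%n+[m/n]*n x n ⟩
      x % n + x / n * n                          ≡⟨ cong₂ (λ r q → r + q * n) x≡y (sym (m+[n∸m]≡n y/n≤x/n)) ⟩
      y % n + (y / n + (x / n ∸ y / n)) * n      ≡⟨ cong (y % n +_) (*-distribʳ-+ n (y / n) (x / n ∸ y / n)) ⟩
      y % n + (y / n * n + (x / n ∸ y / n) * n)  ≡⟨ +-assoc (y % n) (y / n * n) _ ⟨
      (y % n + y / n * n) + (x / n ∸ y / n) * n  ≡⟨ cong (_+ (x / n ∸ y / n) * n) (m≡m%n+[m/n]*n y n) ⟨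
      y + (x / n ∸ y / n) * n                    ∎
      where open ≡-Reasoning

    shift⇔%-≡ : ∀ {x y} → Shifted _≡_ n x y ⇔ x % n ≡ y % n
    shift⇔%-≡ {x} {y} = mk⇔ to from
      where
      to : Shifted _≡_ n x y → x % n ≡ y % n
      to (shiftʳ k x≡y+kn) = trans (cong (_% n) x≡y+kn) ([m+kn]%n≡m%n y k n)
      to (shiftˡ k x+kn≡y) = trans (sym ([m+kn]%n≡m%n x k n)) (cong (_% n) x+kn≡y)
      from : x % n ≡ y % n → Shifted _≡_ n x y
      from x≡y with ≤-total (y / n) (x / n)
      ... | inj₁ y/n≤x/n = shiftʳ (x / n ∸ y / n) (%-≡⇒shift x≡y y/n≤x/n)
      ... | inj₂ x/n≤y/n = shiftˡ (y / n ∸ x / n) (sym (%-≡⇒shift (sym x≡y) x/n≤y/n))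

    %-≡-+ˡ : ∀ c {x y} → x % n ≡ y % n → (c + x) % n ≡ (c + y) % n
    %-≡-+ˡ c {x} {y} x≡y = begin
      (c + x) % n          ≡⟨ %-distribˡ-+ c x n ⟩
      (c % n + x % n) % n  ≡⟨ cong (λ r → (c % n + r) % n) x≡y ⟩
      (c % n + y % n) % n  ≡⟨ %-distribˡ-+ c y n ⟨
      (c + y) % n          ∎
      where open ≡-Reasoning

    +-*-no-wrap : ∀ {u v} k → u < n → v < n → u + k * n ≡ v → u ≡ v
    +-*-no-wrap {u} zero    _ _   e = trans (sym (+-identityʳ u)) e
    +-*-no-wrap {u} (suc k) _ v<n e = ⊥-elim (<-irrefl (sym e) (<-≤-trans v<n (≤-trans (m≤m+n n (k * n)) (m≤n+m _ u))))

    %-≡-cancelʳ : ∀ {t t′} m → t < n → t′ < n → (t + m) % n ≡ (t′ + m) % n → t ≡ t′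
    %-≡-cancelʳ {t} {t′} m t<n t′<n eq with Equivalence.from shift⇔%-≡ eq
    ... | shiftʳ k e = sym (+-*-no-wrap k t′<n t<n (sym (+-cancelʳ-≡ m t (t′ + k * n) (trans e (xy∙z≈xz∙y t′ m (k * n))))))
    ... | shiftˡ k e = +-*-no-wrap k t<n t′<n (+-cancelʳ-≡ m (t + k * n) t′ (trans (xy∙z≈xz∙y t (k * n) m) e))

    %-≡-cancelˡ : ∀ {t t′} m → t < n → t′ < n → (m + t) % n ≡ (m + t′) % n → t ≡ t′
    %-≡-cancelˡ {t} {t′} m t<n t′<n eq =
      %-≡-cancelʳ m t<n t′<n (subst₂ (λ x y → x % n ≡ y % n) (+-comm m t) (+-comm m t′) eq)

module IntegerArcs where

  open import Defs hiding (sym)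
  open Embedding
  open CircleArcs
  open import Data.Integer as ℤ using (ℤ; +_; -[1+_])
  open import Data.Nat as ℕ using (ℕ; suc)
  import Data.Nat.Properties as ℕₚ
  open import Data.Product using (_×_; _,_)
  open import Data.Rational using (_/_; _<_; _≤_; _+_; _*_; _-_; -_)
  open import Data.Rational.Properties using (+-monoˡ-<; module ≤-Reasoning)
  open import Data.Rational.Solver using (module +-*-Solver)
  open import Data.Sum using (inj₁; inj₂)
  open import Function.Bundles using (_⇔_; mk⇔)
  open import Relation.Binary.PropositionalEquality
  open import Algebra.Properties.CommutativeSemigroup ℕₚ.+-commutativeSemigroup using (xy∙z≈xz∙y)
  open +-*-Solver using (solve; _:=_; _:+_; _:-_)

  IntervalsMeet : ℕ → ℕ → ℕ → ℕ → Set
  IntervalsMeet s e t f = t ℕ.< e × s ℕ.< f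

  data ArcsMeet (L s e t f : ℕ) : Set where
    meetʳ : ∀ k → IntervalsMeet s e (t ℕ.+ k ℕ.* L) (f ℕ.+ k ℕ.* L) → ArcsMeet L s e t f
    meetˡ : ∀ k → IntervalsMeet (s ℕ.+ k ℕ.* L) (e ℕ.+ k ℕ.* L) t f → ArcsMeet L s e t f

  ArcsMeet-sym : ∀ {L s e t f} → ArcsMeet L s e t f → ArcsMeet L t f s e
  ArcsMeet-sym (meetʳ k (t<e , s<f)) = meetˡ k (s<f , t<e)
  ArcsMeet-sym (meetˡ k (t<e , s<f)) = meetʳ k (s<f , t<e)

  halfOpen : ∀ {L a w} m k → a ℕ.≤ m ℕ.+ k ℕ.* L → m ℕ.+ k ℕ.* L ℕ.< a ℕ.+ w →
             InHalfOpenArc ⟦ L ⟧ ⟦ a ⟧ ⟦ w ⟧ ⟦ m ⟧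
  halfOpen {L} {a} {w} m k a≤ <a+w =
    + k , subst (⟦ a ⟧ ≤_) position (⟦⟧-mono-≤ a≤) , subst₂ _<_ position (⟦⟧-homo-+ a w) (⟦⟧-mono-< <a+w)
    where
    position : ⟦ m ℕ.+ k ℕ.* L ⟧ ≡ ⟦ m ⟧ + (+ k / 1) * ⟦ L ⟧
    position = trans (⟦⟧-homo-+ m (k ℕ.* L)) (cong (_+_ ⟦ m ⟧) (sym (+k/1*⟦L⟧ k L)))

  common-point⇒overlap : ∀ {L s ℓ t ℓ′} m k →
                         s ℕ.≤ m ℕ.+ k ℕ.* L → m ℕ.+ k ℕ.* L ℕ.< s ℕ.+ ℓ →
                         t ℕ.≤ m ℕ.+ 0 → m ℕ.+ 0 ℕ.< t ℕ.+ ℓ′ →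
                         Overlap ⟦ L ⟧ ⟦ s ⟧ ⟦ ℓ ⟧ ⟦ t ⟧ ⟦ ℓ′ ⟧
  common-point⇒overlap {L} {s} {ℓ} {t} {ℓ′} m k s≤ <s+ℓ t≤ <t+ℓ′ =
    start∈-both⇒overlap {⟦ L ⟧} {⟦ s ⟧} {⟦ ℓ ⟧} {⟦ t ⟧} {⟦ ℓ′ ⟧} {⟦ m ⟧}
      (halfOpen {L} {s} {ℓ} m k s≤ <s+ℓ) (halfOpen {L} {t} {ℓ′} m 0 t≤ <t+ℓ′)

  intervalsMeet⇒overlap : ∀ {L s ℓ t ℓ′} → 0 ℕ.< ℓ → 0 ℕ.< ℓ′ → ∀ k →
                          IntervalsMeet s (s ℕ.+ ℓ) (t ℕ.+ k ℕ.* L) ((t ℕ.+ ℓ′) ℕ.+ k ℕ.* L) →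
                          Overlap ⟦ L ⟧ ⟦ s ⟧ ⟦ ℓ ⟧ ⟦ t ⟧ ⟦ ℓ′ ⟧
  intervalsMeet⇒overlap {L} {s} {ℓ} {t} {ℓ′} 0<ℓ 0<ℓ′ k (t+kL<s+ℓ , s<t+ℓ′+kL)
    with ℕₚ.≤-total s (t ℕ.+ k ℕ.* L)
  ... | inj₁ s≤t+kL =
    common-point⇒overlap {L} {s} {ℓ} {t} {ℓ′} t k s≤t+kL t+kL<s+ℓ (ℕₚ.m≤m+n t 0) (ℕₚ.+-monoʳ-< t 0<ℓ′)
  ... | inj₂ t+kL≤s with ℕₚ.m≤n⇒∃[o]m+o≡n t+kL≤s
  ...   | o , t+kL+o≡s = common-point⇒overlap {L} {s} {ℓ} {t} {ℓ′} (t ℕ.+ o) k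
          (ℕₚ.≤-reflexive (sym m+kL≡s)) (subst (ℕ._< s ℕ.+ ℓ) (sym m+kL≡s) (ℕₚ.m<m+n s 0<ℓ))
          (ℕₚ.≤-trans (ℕₚ.m≤m+n t o) (ℕₚ.m≤m+n (t ℕ.+ o) 0))
          (subst (ℕ._< t ℕ.+ ℓ′) (sym (ℕₚ.+-identityʳ (t ℕ.+ o))) (ℕₚ.+-monoʳ-< t o<ℓ′))
    where
    m+kL≡s : t ℕ.+ o ℕ.+ k ℕ.* L ≡ s
    m+kL≡s = trans (xy∙z≈xz∙y t o (k ℕ.* L)) t+kL+o≡s
    o<ℓ′ : o ℕ.< ℓ′
    o<ℓ′ = ℕₚ.+-cancelˡ-< (t ℕ.+ k ℕ.* L) o ℓ′
             (subst₂ ℕ._<_ (sym t+kL+o≡s) (xy∙z≈xz∙y t ℓ′ (k ℕ.* L)) s<t+ℓ′+kL)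

  arcsMeet⇒overlap : ∀ {L s ℓ t ℓ′} → 0 ℕ.< ℓ → 0 ℕ.< ℓ′ →
                     ArcsMeet L s (s ℕ.+ ℓ) t (t ℕ.+ ℓ′) → Overlap ⟦ L ⟧ ⟦ s ⟧ ⟦ ℓ ⟧ ⟦ t ⟧ ⟦ ℓ′ ⟧
  arcsMeet⇒overlap {L} {s} {ℓ} {t} {ℓ′} 0<ℓ 0<ℓ′ (meetʳ k meet) =
    intervalsMeet⇒overlap {L} {s} {ℓ} {t} {ℓ′} 0<ℓ 0<ℓ′ k meet
  arcsMeet⇒overlap {L} {s} {ℓ} {t} {ℓ′} 0<ℓ 0<ℓ′ (meetˡ k (t<s+ℓ , s<t+ℓ′)) =
    Overlap-swap {⟦ L ⟧} {⟦ t ⟧} {⟦ ℓ′ ⟧} {⟦ s ⟧} {⟦ ℓ ⟧}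
      (intervalsMeet⇒overlap {L} {t} {ℓ′} {s} {ℓ} 0<ℓ′ 0<ℓ k (s<t+ℓ′ , t<s+ℓ))

  -- The sign of the winding number z decides which of the two arcs is shifted forward.
  wound⇒arcsMeet : ∀ {L s ℓ t ℓ′} z →
                   ⟦ t ⟧ + (z / 1) * ⟦ L ⟧ < ⟦ s ⟧ + ⟦ ℓ ⟧ →
                   ⟦ s ⟧ < (⟦ t ⟧ + ⟦ ℓ′ ⟧) + (z / 1) * ⟦ L ⟧ →
                   ArcsMeet L s (s ℕ.+ ℓ) t (t ℕ.+ ℓ′)
  wound⇒arcsMeet {L} {s} {ℓ} {t} {ℓ′} (+ k) lower upper = meetʳ k (⟦⟧-cancel-< lower′ , ⟦⟧-cancel-< upper′)
    where
    lower′ : ⟦ t ℕ.+ k ℕ.* L ⟧ < ⟦ s ℕ.+ ℓ ⟧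
    lower′ = subst₂ _<_ (trans (cong (_+_ ⟦ t ⟧) (+k/1*⟦L⟧ k L)) (sym (⟦⟧-homo-+ t _))) (sym (⟦⟧-homo-+ s ℓ)) lower
    upper′ : ⟦ s ⟧ < ⟦ (t ℕ.+ ℓ′) ℕ.+ k ℕ.* L ⟧
    upper′ = subst (⟦ s ⟧ <_)
      (trans (cong₂ _+_ (sym (⟦⟧-homo-+ t ℓ′)) (+k/1*⟦L⟧ k L)) (sym (⟦⟧-homo-+ (t ℕ.+ ℓ′) _))) upper
  wound⇒arcsMeet {L} {s} {ℓ} {t} {ℓ′} -[1+ k ] lower upper =
    meetˡ (suc k) (⟦⟧-cancel-< lower′ , ⟦⟧-cancel-< upper′)
    where
    K = ⟦ suc k ℕ.* L ⟧
    open ≤-Reasoning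
    lower′ : ⟦ t ⟧ < ⟦ (s ℕ.+ ℓ) ℕ.+ suc k ℕ.* L ⟧
    lower′ = begin-strict
      ⟦ t ⟧                                  ≡⟨ solve 2 (λ t K → t := (t :- K) :+ K) refl ⟦ t ⟧ K ⟩
      (⟦ t ⟧ - K) + K                        ≡⟨ cong (λ x → (⟦ t ⟧ + x) + K) (-[1+k]/1*⟦L⟧ k L) ⟨
      (⟦ t ⟧ + (-[1+ k ] / 1) * ⟦ L ⟧) + K   <⟨ +-monoˡ-< K lower ⟩
      (⟦ s ⟧ + ⟦ ℓ ⟧) + K                    ≡⟨ trans (⟦⟧-homo-+ (s ℕ.+ ℓ) _) (cong (_+ K) (⟦⟧-homo-+ s ℓ)) ⟨
      ⟦ (s ℕ.+ ℓ) ℕ.+ suc k ℕ.* L ⟧          ∎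
    upper′ : ⟦ s ℕ.+ suc k ℕ.* L ⟧ < ⟦ t ℕ.+ ℓ′ ⟧
    upper′ = begin-strict
      ⟦ s ℕ.+ suc k ℕ.* L ⟧                             ≡⟨ ⟦⟧-homo-+ s _ ⟩
      ⟦ s ⟧ + K                                         <⟨ +-monoˡ-< K upper ⟩
      ((⟦ t ⟧ + ⟦ ℓ′ ⟧) + (-[1+ k ] / 1) * ⟦ L ⟧) + K
        ≡⟨ cong (λ x → ((⟦ t ⟧ + ⟦ ℓ′ ⟧) + x) + K) (-[1+k]/1*⟦L⟧ k L) ⟩
      ((⟦ t ⟧ + ⟦ ℓ′ ⟧) - K) + K
        ≡⟨ solve 2 (λ x K → (x :- K) :+ K := x) refl (⟦ t ⟧ + ⟦ ℓ′ ⟧) K ⟩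
      ⟦ t ⟧ + ⟦ ℓ′ ⟧                                    ≡⟨ ⟦⟧-homo-+ t ℓ′ ⟨
      ⟦ t ℕ.+ ℓ′ ⟧                                      ∎

  overlap⇒arcsMeet : ∀ {L s ℓ t ℓ′} → Overlap ⟦ L ⟧ ⟦ s ⟧ ⟦ ℓ ⟧ ⟦ t ⟧ ⟦ ℓ′ ⟧ →
                     ArcsMeet L s (s ℕ.+ ℓ) t (t ℕ.+ ℓ′)
  overlap⇒arcsMeet {L} {s} {ℓ} {t} {ℓ′} (c , (k₁ , s<c₁ , c₁<s+ℓ) , (k₂ , t<c₂ , c₂<t+ℓ′)) =
    wound⇒arcsMeet (k₁ ℤ.- k₂) lower upper
    where
    open ≤-Reasoning
    Z = ((k₁ ℤ.- k₂) / 1) * ⟦ L ⟧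
    lower : ⟦ t ⟧ + Z < ⟦ s ⟧ + ⟦ ℓ ⟧
    lower = begin-strict
      ⟦ t ⟧ + Z                    <⟨ +-monoˡ-< Z t<c₂ ⟩
      (c + (k₂ / 1) * ⟦ L ⟧) + Z   ≡⟨ shift-frame ⟦ L ⟧ c k₂ k₁ ⟩
      c + (k₁ / 1) * ⟦ L ⟧         <⟨ c₁<s+ℓ ⟩
      ⟦ s ⟧ + ⟦ ℓ ⟧                ∎
    upper : ⟦ s ⟧ < (⟦ t ⟧ + ⟦ ℓ′ ⟧) + Z
    upper = begin-strict
      ⟦ s ⟧                        <⟨ s<c₁ ⟩
      c + (k₁ / 1) * ⟦ L ⟧         ≡⟨ shift-frame ⟦ L ⟧ c k₂ k₁ ⟨
      (c + (k₂ / 1) * ⟦ L ⟧) + Z   <⟨ +-monoˡ-< Z c₂<t+ℓ′ ⟩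
      (⟦ t ⟧ + ⟦ ℓ′ ⟧) + Z         ∎

  overlap⇔arcsMeet : ∀ {L s ℓ t ℓ′} → 0 ℕ.< ℓ → 0 ℕ.< ℓ′ →
                     Overlap ⟦ L ⟧ ⟦ s ⟧ ⟦ ℓ ⟧ ⟦ t ⟧ ⟦ ℓ′ ⟧ ⇔ ArcsMeet L s (s ℕ.+ ℓ) t (t ℕ.+ ℓ′)
  overlap⇔arcsMeet 0<ℓ 0<ℓ′ = mk⇔ overlap⇒arcsMeet (arcsMeet⇒overlap 0<ℓ 0<ℓ′)

module GridArcs where

  open Residues
  open IntegerArcs using (IntervalsMeet; ArcsMeet; meetʳ; meetˡ)
  open import Data.Nat using (ℕ; suc; _+_; _*_; _≤_; _<_; z≤n; z<s; s<s; NonZero)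
  open import Data.Nat.DivMod using (_%_)
  open import Data.Nat.Properties
  open import Data.Nat.Solver using (module +-*-Solver)
  open import Data.Product using (_,_)
  open import Data.Sum using (_⊎_; inj₁; inj₂)
  open import Data.Sum.Function.Propositional using (_⊎-⇔_)
  open import Function.Bundles using (_⇔_; mk⇔; Equivalence)
  open import Function.Construct.Composition using (_⇔-∘_)
  open import Relation.Binary.PropositionalEquality
  open import Relation.Nullary using (¬_)
  open +-*-Solver

  module _ (q x y : ℕ) {r s : ℕ} where

    *+-<⇒< : q * x + r < q * y + s → s ≤ r → x < y
    *+-<⇒< lt s≤r = *-cancelˡ-< q x y (+-cancelʳ-< s (q * x) (q * y) (≤-<-trans (+-monoʳ-≤ (q * x) s≤r) lt))

    *+-<⇒≤ : q * x + r < q * y + s → s < q → x ≤ y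
    *+-<⇒≤ lt s<q = m<1+n⇒m≤n (*-cancelˡ-< q x (suc y) (begin-strict
      q * x      ≤⟨ m≤m+n (q * x) r ⟩
      q * x + r  <⟨ lt ⟩
      q * y + s  <⟨ +-monoʳ-< (q * y) s<q ⟩
      q * y + q  ≡⟨ trans (+-comm (q * y) q) (sym (*-suc q y)) ⟩
      q * suc y  ∎))
      where open ≤-Reasoning

    <⇒*+-< : x < y → r < q → q * x + r < q * y + s
    <⇒*+-< x<y r<q = begin-strict
      q * x + r  <⟨ +-monoʳ-< (q * x) r<q ⟩
      q * x + q  ≡⟨ trans (+-comm (q * x) q) (sym (*-suc q x)) ⟩
      q * suc x  ≤⟨ *-monoʳ-≤ q x<y ⟩
      q * y      ≤⟨ m≤m+n (q * y) s ⟩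
      q * y + s  ∎
      where open ≤-Reasoning

    ≤⇒*+-< : x ≤ y → r < s → q * x + r < q * y + s
    ≤⇒*+-< x≤y r<s = +-mono-≤-< (*-monoʳ-≤ q x≤y) r<s

  data Kind : Set where
    A B C : Kind

  side : Kind → ℕ
  side A = 3
  side B = 4
  side C = 1

  startOf endOf : Kind → ℕ → ℕ
  startOf A X = 4 * X + 0
  startOf B X = 4 * X + 2
  startOf C X = 4 * X + 3
  endOf A X = 4 * X + 3
  endOf B X = 4 * suc X + 2
  endOf C X = 4 * suc X + 0

  startOf+side : ∀ κ X → startOf κ X + side κ ≡ endOf κ X
  startOf+side A X = +-assoc (4 * X) 0 3
  startOf+side B X = solve 1 (λ X → con 4 :* X :+ con 2 :+ con 4 := con 4 :* (con 1 :+ X) :+ con 2) refl X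
  startOf+side C X = solve 1 (λ X → con 4 :* X :+ con 3 :+ con 1 := con 4 :* (con 1 :+ X) :+ con 0) refl X

  GridMeet : Kind → Kind → ℕ → ℕ → Set
  GridMeet κ κ′ X Y = IntervalsMeet (startOf κ X) (endOf κ X) (startOf κ′ Y) (endOf κ′ Y)

  between-suc : ∀ {X Y} → Y ≤ X → X ≤ suc Y → X ≡ Y ⊎ X ≡ suc Y
  between-suc Y≤X X≤1+Y with m≤n⇒m<n∨m≡n X≤1+Y
  ... | inj₁ X<1+Y = inj₁ (≤-antisym (m<1+n⇒m≤n X<1+Y) Y≤X)
  ... | inj₂ X≡1+Y = inj₂ X≡1+Y

  gridMeet-AA : ∀ X Y → GridMeet A A X Y → X ≡ Y
  gridMeet-AA X Y (Y<X , X<Y) = ≤-antisym (*+-<⇒≤ 4 X Y X<Y (n<1+n 3)) (*+-<⇒≤ 4 Y X Y<X (n<1+n 3))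

  gridMeet-BB : ∀ X Y → GridMeet B B X Y → X ≡ Y
  gridMeet-BB X Y (Y<X , X<Y) =
    ≤-antisym (m<1+n⇒m≤n (*+-<⇒< 4 X (suc Y) X<Y ≤-refl)) (m<1+n⇒m≤n (*+-<⇒< 4 Y (suc X) Y<X ≤-refl))

  gridMeet-AB : ∀ X Y → GridMeet A B X Y ⇔ (X ≡ Y ⊎ X ≡ suc Y)
  gridMeet-AB X Y = mk⇔ to from
    where
    to : GridMeet A B X Y → X ≡ Y ⊎ X ≡ suc Y
    to (Y<X , X<Y) = between-suc (*+-<⇒≤ 4 Y X Y<X (n<1+n 3)) (*+-<⇒≤ 4 X (suc Y) X<Y (s<s (s<s z<s)))
    from : X ≡ Y ⊎ X ≡ suc Y → GridMeet A B X Y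
    from (inj₁ refl) = ≤⇒*+-< 4 X X ≤-refl (n<1+n 2) , ≤⇒*+-< 4 X (suc X) (n≤1+n X) z<s
    from (inj₂ refl) = ≤⇒*+-< 4 Y (suc Y) (n≤1+n Y) (n<1+n 2) , ≤⇒*+-< 4 (suc Y) (suc Y) ≤-refl z<s

  gridMeet-AC : ∀ X Y → ¬ GridMeet A C X Y
  gridMeet-AC X Y (Y<X , X<Y) = <⇒≱ (*+-<⇒< 4 Y X Y<X ≤-refl) (m<1+n⇒m≤n (*+-<⇒< 4 X (suc Y) X<Y ≤-refl))

  gridMeet-BC : ∀ X Y → GridMeet B C X Y ⇔ X ≡ Y
  gridMeet-BC X Y = mk⇔ to from
    where
    to : GridMeet B C X Y → X ≡ Y
    to (Y<X , X<Y) = ≤-antisym (m<1+n⇒m≤n (*+-<⇒< 4 X (suc Y) X<Y z≤n)) (m<1+n⇒m≤n (*+-<⇒< 4 Y (suc X) Y<X (s<s z<s)))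
    from : X ≡ Y → GridMeet B C X Y
    from refl = <⇒*+-< 4 X (suc X) (n<1+n X) (n<1+n 3) , <⇒*+-< 4 X (suc X) (n<1+n X) (s<s (s<s z<s))

  GridArcsMeet : ℕ → Kind → Kind → ℕ → ℕ → Set
  GridArcsMeet p κ κ′ X Y = ArcsMeet (4 * p) (startOf κ X) (endOf κ X) (startOf κ′ Y) (endOf κ′ Y)

  grid-shift : ∀ p X r k → 4 * X + r + k * (4 * p) ≡ 4 * (X + k * p) + r
  grid-shift p X r k = solve 4 (λ p X r k → con 4 :* X :+ r :+ k :* (con 4 :* p) := con 4 :* (X :+ k :* p) :+ r) refl p X r k

  startOf-shift : ∀ p κ X k → startOf κ X + k * (4 * p) ≡ startOf κ (X + k * p)
  startOf-shift p A X k = grid-shift p X 0 k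
  startOf-shift p B X k = grid-shift p X 2 k
  startOf-shift p C X k = grid-shift p X 3 k

  endOf-shift : ∀ p κ X k → endOf κ X + k * (4 * p) ≡ endOf κ (X + k * p)
  endOf-shift p A X k = grid-shift p X 3 k
  endOf-shift p B X k = grid-shift p (suc X) 2 k
  endOf-shift p C X k = grid-shift p (suc X) 0 k

  gridArcsMeet⇔shifted : ∀ {p} κ κ′ {X Y} → GridArcsMeet p κ κ′ X Y ⇔ Shifted (GridMeet κ κ′) p X Y
  gridArcsMeet⇔shifted {p} κ κ′ {X} {Y} = mk⇔ to from
    where
    shifted-first : ℕ → ℕ → Set
    shifted-first s e = IntervalsMeet s e (startOf κ′ Y) (endOf κ′ Y)
    shifted-second : ℕ → ℕ → Set
    shifted-second = IntervalsMeet (startOf κ X) (endOf κ X)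
    to : GridArcsMeet p κ κ′ X Y → Shifted (GridMeet κ κ′) p X Y
    to (meetʳ k m) = shiftʳ k (subst₂ shifted-second (startOf-shift p κ′ Y k) (endOf-shift p κ′ Y k) m)
    to (meetˡ k m) = shiftˡ k (subst₂ shifted-first (startOf-shift p κ X k) (endOf-shift p κ X k) m)
    from : Shifted (GridMeet κ κ′) p X Y → GridArcsMeet p κ κ′ X Y
    from (shiftʳ k m) = meetʳ k (subst₂ shifted-second (sym (startOf-shift p κ′ Y k)) (sym (endOf-shift p κ′ Y k)) m)
    from (shiftˡ k m) = meetˡ k (subst₂ shifted-first (sym (startOf-shift p κ X k)) (sym (endOf-shift p κ X k)) m)

  module _ {p : ℕ} {{_ : NonZero p}} {X Y : ℕ} where

    gridArcsMeet-AA : GridArcsMeet p A A X Y → X % p ≡ Y % p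
    gridArcsMeet-AA m = Equivalence.to shift⇔%-≡ (Shifted-map gridMeet-AA (Equivalence.to (gridArcsMeet⇔shifted A A) m))

    gridArcsMeet-BB : GridArcsMeet p B B X Y → X % p ≡ Y % p
    gridArcsMeet-BB m = Equivalence.to shift⇔%-≡ (Shifted-map gridMeet-BB (Equivalence.to (gridArcsMeet⇔shifted B B) m))

    gridArcsMeet-AC : ¬ GridArcsMeet p A C X Y
    gridArcsMeet-AC m with Equivalence.to (gridArcsMeet⇔shifted {p} A C {X} {Y}) m
    ... | shiftʳ k g = gridMeet-AC X (Y + k * p) g
    ... | shiftˡ k g = gridMeet-AC (X + k * p) Y g

    gridArcsMeet-AB : GridArcsMeet p A B X Y ⇔ (X % p ≡ Y % p ⊎ X % p ≡ suc Y % p)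
    gridArcsMeet-AB = (shift⇔%-≡ ⊎-⇔ (shift⇔%-≡ ⇔-∘ Shifted-suc))
      ⇔-∘ (Shifted-⊎ {_≡_} {λ X Y → X ≡ suc Y}
      ⇔-∘ (Shifted-cong {GridMeet A B} {λ X Y → X ≡ Y ⊎ X ≡ suc Y} gridMeet-AB
      ⇔-∘ gridArcsMeet⇔shifted {p} A B {X} {Y}))

    gridArcsMeet-BC : GridArcsMeet p B C X Y ⇔ X % p ≡ Y % p
    gridArcsMeet-BC = shift⇔%-≡ ⇔-∘ (Shifted-cong {GridMeet B C} {_≡_} gridMeet-BC ⇔-∘ gridArcsMeet⇔shifted {p} B C {X} {Y})

module Extremal where

  open import Defs hiding (sym)
  open Counting
  open Embedding using (⟦_⟧; ⟦⟧-mono-<; ⟦⟧-mono-≤)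
  open CircleArcs using (Overlap)
  open UpperBound using (Axis; horizontal; vertical; SeesAlong; numEdges≤2n)
  open Residues using (%-≡-+ˡ; %-≡-cancelʳ; %-≡-cancelˡ)
  open IntegerArcs using (ArcsMeet; ArcsMeet-sym; overlap⇔arcsMeet)
  open GridArcs
  open import Data.Bool using (Bool; true; false; not; _∨_)
  open import Data.Empty using (⊥; ⊥-elim)
  open import Data.Fin as Fin using (Fin; zero; suc; toℕ; _↑ˡ_; _↑ʳ_; splitAt; fromℕ<; inject≤)
  import Data.Fin.Properties as Finₚ
  open import Data.Nat as ℕ using (ℕ; zero; suc; _+_; _*_; _≤_; _<_; NonZero; z≤n; s≤s; z<s; _≟_)
  open import Data.Nat.DivMod using (_%_; m%n<n; m%n%n≡m%n)
  open import Data.Nat.Properties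
  open import Algebra.Properties.Semiring.Sum +-*-semiring using (sum-syntax; sum-cong-≗)
  open import Data.Product using (Σ; _×_; _,_; proj₂)
  open import Data.Rational using (ℚ)
  open import Data.Sum using (_⊎_; inj₁; inj₂; [_,_]′)
  open import Data.Sum.Function.Propositional using (_⊎-⇔_)
  open import Function using (_∘_)
  open import Function.Bundles using (_⇔_; mk⇔; Equivalence)
  open import Function.Construct.Composition using (_⇔-∘_)
  import Function.Properties.Equivalence as ⇔
  open import Relation.Binary.PropositionalEquality
  open import Relation.Nullary using (does; ¬_)
  open import Relation.Nullary.Decidable using (dec-true)

  ∨⇔⊎ : ∀ {x y} → x ∨ y ≡ true ⇔ (x ≡ true ⊎ y ≡ true)
  ∨⇔⊎ {true}  = mk⇔ (λ _ → inj₁ refl) (λ _ → refl)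
  ∨⇔⊎ {false} = mk⇔ inj₂ [ (λ ()) , (λ y≡true → y≡true) ]′

  Fin-≤1 : ∀ {m} → suc m ≤ 1 → ¬ Fin m
  Fin-≤1 (s≤s ()) zero
  Fin-≤1 (s≤s ()) (suc _)

  module Construction (p : ℕ) (4≤p : 4 ≤ p) (e : ℕ) (e≤1 : e ≤ 1) where

    instance
      p-nonZero : NonZero p
      p-nonZero = ℕ.>-nonZero (<-≤-trans z<s 4≤p)

    data Vertex : Set where
      a b : Fin p → Vertex
      c   : Fin e → Vertex

    N : ℕ
    N = p + (p + e)

    vertex : Fin N → Vertex
    vertex u = [ a , [ b , c ]′ ∘ splitAt p ]′ (splitAt p u)

    index : Vertex → Fin N
    index (a i) = i ↑ˡ (p + e)
    index (b j) = p ↑ʳ (j ↑ˡ e)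
    index (c k) = p ↑ʳ (p ↑ʳ k)

    vertex-index : ∀ v → vertex (index v) ≡ v
    vertex-index (a i) rewrite Finₚ.splitAt-↑ˡ p i (p + e) = refl
    vertex-index (b j) rewrite Finₚ.splitAt-↑ʳ p (p + e) (j ↑ˡ e) | Finₚ.splitAt-↑ˡ p j e = refl
    vertex-index (c k) rewrite Finₚ.splitAt-↑ʳ p (p + e) (p ↑ʳ k) | Finₚ.splitAt-↑ʳ p e k = refl

    index-vertex : ∀ u → index (vertex u) ≡ u
    index-vertex u with splitAt p u in split₁
    ... | inj₁ i = Finₚ.splitAt⁻¹-↑ˡ split₁
    ... | inj₂ r with splitAt p r in split₂
    ...   | inj₁ j = trans (cong (p ↑ʳ_) (Finₚ.splitAt⁻¹-↑ˡ split₂)) (Finₚ.splitAt⁻¹-↑ʳ split₁)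
    ...   | inj₂ k = trans (cong (p ↑ʳ_) (Finₚ.splitAt⁻¹-↑ʳ split₂)) (Finₚ.splitAt⁻¹-↑ʳ split₁)

    index-injective : ∀ {u v} → index u ≡ index v → u ≡ v
    index-injective {u} {v} eq = trans (sym (vertex-index u)) (trans (cong vertex eq) (vertex-index v))

    vertex-≢ : ∀ {i j} → i ≢ j → vertex i ≢ vertex j
    vertex-≢ {i} {j} i≢j eq = i≢j (trans (sym (index-vertex i)) (trans (cong index eq) (index-vertex j)))

    b-injective : ∀ {j j′} → b j ≡ b j′ → j ≡ j′
    b-injective refl = refl

    c-unique : (k k′ : Fin e) → k ≡ k′
    c-unique zero    zero    = refl
    c-unique zero    (suc k) = ⊥-elim (Fin-≤1 e≤1 k)
    c-unique (suc k) _       = ⊥-elim (Fin-≤1 e≤1 k)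

    ∑-vertices : (f : Vertex → ℕ) →
                 ∑[ u < N ] f (vertex u) ≡ ∑[ i < p ] f (a i) + (∑[ j < p ] f (b j) + ∑[ k < e ] f (c k))
    ∑-vertices f = begin
      ∑[ u < N ] f (vertex u)
        ≡⟨ ∑-↑ p (p + e) (f ∘ vertex) ⟩
      ∑[ i < p ] f (vertex (index (a i))) + ∑[ r < p + e ] f (vertex (p ↑ʳ r))
        ≡⟨ cong₂ _+_ (sum-cong-≗ (cong f ∘ vertex-index ∘ a)) (∑-↑ p e (f ∘ vertex ∘ (p ↑ʳ_))) ⟩
      ∑[ i < p ] f (a i) + (∑[ j < p ] f (vertex (index (b j))) + ∑[ k < e ] f (vertex (index (c k))))
        ≡⟨ cong (∑[ i < p ] f (a i) +_) (cong₂ _+_ (sum-cong-≗ (cong f ∘ vertex-index ∘ b))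
                                                   (sum-cong-≗ (cong f ∘ vertex-index ∘ c))) ⟩
      ∑[ i < p ] f (a i) + (∑[ j < p ] f (b j) + ∑[ k < e ] f (c k))
        ∎
      where open ≡-Reasoning

    kind : Vertex → Kind
    kind (a _) = A
    kind (b _) = B
    kind (c _) = C

    aShift cShift : Axis → ℕ
    aShift vertical   = 1
    aShift horizontal = 3
    cShift vertical   = 0
    cShift horizontal = 1

    cell : Axis → Vertex → ℕ
    cell d (a i) = aShift d + toℕ i
    cell d (b j) = toℕ j
    cell d (c _) = cShift d

    side-pos : ∀ κ → 0 < side κ
    side-pos A = z<s
    side-pos B = z<s
    side-pos C = z<s

    side≤4p : ∀ κ → side κ ≤ 4 * p
    side≤4p κ = ≤-trans (side≤4 κ) (m≤m*n 4 p)
      where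
      side≤4 : ∀ κ → side κ ≤ 4
      side≤4 A = n≤1+n 3
      side≤4 B = ≤-refl
      side≤4 C = s≤s z≤n

    torus : ℚ
    torus = ⟦ 4 * p ⟧

    rect : Vertex → Rect torus torus
    rect v = record
      { x     = ⟦ startOf (kind v) (cell vertical v) ⟧
      ; y     = ⟦ startOf (kind v) (cell horizontal v) ⟧
      ; w     = ⟦ side (kind v) ⟧
      ; h     = ⟦ side (kind v) ⟧
      ; w-pos = ⟦⟧-mono-< (side-pos (kind v))
      ; h-pos = ⟦⟧-mono-< (side-pos (kind v))
      ; w≤W   = ⟦⟧-mono-≤ (side≤4p (kind v))
      ; h≤H   = ⟦⟧-mono-≤ (side≤4p (kind v))
      }

    overlap⇔gridArcsMeet : ∀ κ κ′ X Y →
      Overlap torus ⟦ startOf κ X ⟧ ⟦ side κ ⟧ ⟦ startOf κ′ Y ⟧ ⟦ side κ′ ⟧ ⇔ GridArcsMeet p κ κ′ X Y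
    overlap⇔gridArcsMeet κ κ′ X Y =
      mk⇔ (subst₂ arcs (startOf+side κ X) (startOf+side κ′ Y))
          (subst₂ arcs (sym (startOf+side κ X)) (sym (startOf+side κ′ Y)))
      ⇔-∘ overlap⇔arcsMeet {4 * p} {startOf κ X} {side κ} {startOf κ′ Y} {side κ′} (side-pos κ) (side-pos κ′)
      where
      arcs : ℕ → ℕ → Set
      arcs e f = ArcsMeet (4 * p) (startOf κ X) e (startOf κ′ Y) f

    seesAlong⇔gridArcsMeet : ∀ d u v → SeesAlong d (rect u) (rect v) ⇔ GridArcsMeet p (kind u) (kind v) (cell d u) (cell d v)
    seesAlong⇔gridArcsMeet horizontal u v = overlap⇔gridArcsMeet (kind u) (kind v) _ _
    seesAlong⇔gridArcsMeet vertical   u v = overlap⇔gridArcsMeet (kind u) (kind v) _ _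

    congruent? : ℕ → ℕ → Bool
    congruent? X Y = does (X % p ≟ Y % p)

    congruent?⇔ : ∀ {X Y} → congruent? X Y ≡ true ⇔ X % p ≡ Y % p
    congruent?⇔ {X} {Y} = mk⇔ (does⇒ (X % p ≟ Y % p)) (dec-true (X % p ≟ Y % p))

    aMeetsB? : ℕ → ℕ → Bool
    aMeetsB? X Y = congruent? X Y ∨ congruent? X (suc Y)

    aMeetsB?⇔ : ∀ {X Y} → aMeetsB? X Y ≡ true ⇔ (X % p ≡ Y % p ⊎ X % p ≡ suc Y % p)
    aMeetsB?⇔ = (congruent?⇔ ⊎-⇔ congruent?⇔) ⇔-∘ ∨⇔⊎

    linked : Axis → Vertex → Vertex → Bool
    linked d (a i) (b j) = aMeetsB? (cell d (a i)) (toℕ j)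
    linked d (b j) (a i) = aMeetsB? (cell d (a i)) (toℕ j)
    linked d (b j) (c _) = congruent? (toℕ j) (cShift d)
    linked d (c _) (b j) = congruent? (toℕ j) (cShift d)
    linked _ _     _     = false

    shift-injective : ∀ δ {i i′ : Fin p} → (δ + toℕ i) % p ≡ (δ + toℕ i′) % p → i ≡ i′
    shift-injective δ {i} {i′} eq = Finₚ.toℕ-injective (%-≡-cancelˡ {p} δ (Finₚ.toℕ<n i) (Finₚ.toℕ<n i′) eq)

    gridArcsMeet-swap : ∀ {κ κ′ X Y} → GridArcsMeet p κ κ′ X Y ⇔ GridArcsMeet p κ′ κ Y X
    gridArcsMeet-swap = mk⇔ ArcsMeet-sym ArcsMeet-sym

    linked⇔gridArcsMeet : ∀ d {u v} → u ≢ v → linked d u v ≡ true ⇔ GridArcsMeet p (kind u) (kind v) (cell d u) (cell d v)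
    linked⇔gridArcsMeet d {a i} {a i′} a≢a′ =
      mk⇔ (λ ()) (λ m → ⊥-elim (a≢a′ (cong a (shift-injective (aShift d) (gridArcsMeet-AA m)))))
    linked⇔gridArcsMeet d {a i} {b j}  _    = ⇔.sym gridArcsMeet-AB ⇔-∘ aMeetsB?⇔
    linked⇔gridArcsMeet d {a i} {c k}  _    = mk⇔ (λ ()) (⊥-elim ∘ gridArcsMeet-AC {X = cell d (a i)} {cShift d})
    linked⇔gridArcsMeet d {b j} {a i}  _    =
      gridArcsMeet-swap {A} {B} {cell d (a i)} {toℕ j} ⇔-∘ (⇔.sym gridArcsMeet-AB ⇔-∘ aMeetsB?⇔)
    linked⇔gridArcsMeet d {b j} {b j′} b≢b′ =
      mk⇔ (λ ()) (λ m → ⊥-elim (b≢b′ (cong b (shift-injective 0 (gridArcsMeet-BB m)))))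
    linked⇔gridArcsMeet d {b j} {c k}  _    = ⇔.sym gridArcsMeet-BC ⇔-∘ congruent?⇔
    linked⇔gridArcsMeet d {c k} {a i}  _    =
      mk⇔ (λ ()) (⊥-elim ∘ gridArcsMeet-AC {X = cell d (a i)} {cShift d} ∘ ArcsMeet-sym)
    linked⇔gridArcsMeet d {c k} {b j}  _    =
      gridArcsMeet-swap {B} {C} {toℕ j} {cShift d} ⇔-∘ (⇔.sym gridArcsMeet-BC ⇔-∘ congruent?⇔)
    linked⇔gridArcsMeet d {c k} {c k′} c≢c′ = ⊥-elim (c≢c′ (cong c (c-unique k k′)))

    linked⇔seesAlong : ∀ d {u v} → u ≢ v → linked d u v ≡ true ⇔ SeesAlong d (rect u) (rect v)
    linked⇔seesAlong d {u} {v} u≢v = ⇔.sym (seesAlong⇔gridArcsMeet d u v) ⇔-∘ linked⇔gridArcsMeet d u≢v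

    linked-sym : ∀ d u v → linked d u v ≡ linked d v u
    linked-sym d (a _) (a _) = refl
    linked-sym d (a _) (b _) = refl
    linked-sym d (a _) (c _) = refl
    linked-sym d (b _) (a _) = refl
    linked-sym d (b _) (b _) = refl
    linked-sym d (b _) (c _) = refl
    linked-sym d (c _) (a _) = refl
    linked-sym d (c _) (b _) = refl
    linked-sym d (c _) (c _) = refl

    linked-irrefl : ∀ d v → linked d v v ≡ false
    linked-irrefl d (a _) = refl
    linked-irrefl d (b _) = refl
    linked-irrefl d (c _) = refl

    small<p : ∀ {m} → m ≤ 3 → m < p
    small<p m≤3 = <-≤-trans (s≤s m≤3) 4≤p

    aMeetsB?⇒offset : ∀ {X Y} → aMeetsB? X Y ≡ true → Σ ℕ λ δ → δ ≤ 1 × X % p ≡ (δ + Y) % p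
    aMeetsB?⇒offset m with Equivalence.to aMeetsB?⇔ m
    ... | inj₁ X≡Y   = 0 , z≤n , X≡Y
    ... | inj₂ X≡1+Y = 1 , ≤-refl , X≡1+Y

    not-linked-both-AB : ∀ (i j : Fin p) →
                         aMeetsB? (3 + toℕ i) (toℕ j) ≡ true → aMeetsB? (1 + toℕ i) (toℕ j) ≡ true → ⊥
    not-linked-both-AB i j horizontally vertically
      with aMeetsB?⇒offset horizontally | aMeetsB?⇒offset vertically
    ... | δ₂ , δ₂≤1 , 3+i≡δ₂+j | δ₁ , δ₁≤1 , 1+i≡δ₁+j =
      <⇒≢ (≤-trans (s≤s δ₂≤1) (m≤m+n 2 δ₁))
          (%-≡-cancelʳ {p} (toℕ j) (small<p (≤-trans δ₂≤1 (s≤s z≤n))) (small<p (s≤s (s≤s δ₁≤1)))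
                       (trans (sym 3+i≡δ₂+j) (%-≡-+ˡ {p} 2 1+i≡δ₁+j)))

    not-linked-both-BC : ∀ (j : Fin p) → congruent? (toℕ j) 1 ≡ true → congruent? (toℕ j) 0 ≡ true → ⊥
    not-linked-both-BC j horizontally vertically
      with %-≡-cancelʳ {p} 0 (small<p (s≤s z≤n)) (small<p z≤n)
             (trans (sym (Equivalence.to congruent?⇔ horizontally)) (Equivalence.to congruent?⇔ vertically))
    ... | ()

    not-linked-both : ∀ u v → linked horizontal u v ≡ true → linked vertical u v ≡ true → ⊥
    not-linked-both (a i) (b j) = not-linked-both-AB i j
    not-linked-both (b j) (a i) = not-linked-both-AB i j
    not-linked-both (b j) (c _) = not-linked-both-BC j
    not-linked-both (c _) (b j) = not-linked-both-BC j

    adjacent : Vertex → Vertex → Bool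
    adjacent u v = linked horizontal u v ∨ linked vertical u v

    adjacent⇔sees : ∀ {u v} → u ≢ v → adjacent u v ≡ true ⇔ Sees (rect u) (rect v)
    adjacent⇔sees u≢v = (linked⇔seesAlong horizontal u≢v ⊎-⇔ linked⇔seesAlong vertical u≢v) ⇔-∘ ∨⇔⊎

    adjacent-via : ∀ d {u v} → linked d u v ≡ true → adjacent u v ≡ true
    adjacent-via horizontal l = Equivalence.from ∨⇔⊎ (inj₁ l)
    adjacent-via vertical   l = Equivalence.from ∨⇔⊎ (inj₂ l)

    colour : Vertex → Bool
    colour (b _) = true
    colour _     = false

    adjacent-colour : ∀ u v → adjacent u v ≡ true → colour u ≢ colour v
    adjacent-colour (a _) (b _) _ ()
    adjacent-colour (b _) (a _) _ ()
    adjacent-colour (b _) (c _) _ ()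
    adjacent-colour (c _) (b _) _ ()

    G : Graph N
    G = record
      { adj    = λ i j → adjacent (vertex i) (vertex j)
      ; sym    = λ i j → cong₂ _∨_ (linked-sym horizontal (vertex i) (vertex j)) (linked-sym vertical (vertex i) (vertex j))
      ; irrefl = λ i → cong₂ _∨_ (linked-irrefl horizontal (vertex i)) (linked-irrefl vertical (vertex i))
      }

    bipartite : IsBipartite G
    bipartite = colour ∘ vertex , λ i j → adjacent-colour (vertex i) (vertex j)

    visible : ∀ i j → i ≢ j → (adj G i j ≡ true ⇔ Sees (rect (vertex i)) (rect (vertex j)))
    visible i j i≢j = adjacent⇔sees (vertex-≢ i≢j)

    trvg : IsTRVG G
    trvg = torus , torus , 0<torus , 0<torus , rect ∘ vertex , disjoint , visible
      where
      0<torus = ⟦⟧-mono-< (*-monoʳ-< 4 (<-≤-trans z<s 4≤p))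
      disjoint : ∀ i j → i ≢ j →
                 ¬ (Σ ℚ λ x₀ → Σ ℚ λ y₀ → InInterior (rect (vertex i)) x₀ y₀ × InInterior (rect (vertex j)) x₀ y₀)
      disjoint i j i≢j (x₀ , y₀ , (x₀∈i , y₀∈i) , (x₀∈j , y₀∈j)) =
        not-linked-both (vertex i) (vertex j)
          (Equivalence.from (linked⇔seesAlong horizontal (vertex-≢ i≢j)) (y₀ , y₀∈i , y₀∈j))
          (Equivalence.from (linked⇔seesAlong vertical (vertex-≢ i≢j)) (x₀ , x₀∈i , x₀∈j))

    adj-index : ∀ u v → adj G (index u) (index v) ≡ adjacent u v
    adj-index u v = cong₂ adjacent (vertex-index u) (vertex-index v)

    neighbour : Fin p → Fin 4 → Fin p
    neighbour i t = fromℕ< (m%n<n (toℕ t + toℕ i) p)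

    neighbour-% : ∀ i t → toℕ (neighbour i t) % p ≡ (toℕ t + toℕ i) % p
    neighbour-% i t = trans (cong (_% p) (Finₚ.toℕ-fromℕ< _)) (m%n%n≡m%n (toℕ t + toℕ i) p)

    neighbour-injective : ∀ i {t t′} → neighbour i t ≡ neighbour i t′ → t ≡ t′
    neighbour-injective i {t} {t′} eq = Finₚ.toℕ-injective
      (%-≡-cancelʳ {p} (toℕ i) (<-≤-trans (Finₚ.toℕ<n t) 4≤p) (<-≤-trans (Finₚ.toℕ<n t′) 4≤p)
                   (Finₚ.fromℕ<-injective _ _ _ _ eq))

    a-sees-b : ∀ d i j → cell d (a i) % p ≡ toℕ j % p ⊎ cell d (a i) % p ≡ suc (toℕ j) % p → adjacent (a i) (b j) ≡ true
    a-sees-b d i j residues = adjacent-via d {a i} {b j} (Equivalence.from aMeetsB?⇔ residues)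

    a-sees-neighbour : ∀ i t → adjacent (a i) (b (neighbour i t)) ≡ true
    a-sees-neighbour i t@zero                   = a-sees-b vertical   i _ (inj₂ (%-≡-+ˡ {p} 1 (sym (neighbour-% i t))))
    a-sees-neighbour i t@(suc zero)             = a-sees-b vertical   i _ (inj₁ (sym (neighbour-% i t)))
    a-sees-neighbour i t@(suc (suc zero))       = a-sees-b horizontal i _ (inj₂ (%-≡-+ˡ {p} 1 (sym (neighbour-% i t))))
    a-sees-neighbour i t@(suc (suc (suc zero))) = a-sees-b horizontal i _ (inj₁ (sym (neighbour-% i t)))

    degree-a : ∀ i → 4 ≤ degree G (index (a i))
    degree-a i = injection⇒≤∑b2n (adj G (index (a i))) (index ∘ b ∘ neighbour i)
      (neighbour-injective i ∘ b-injective ∘ index-injective)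
      (λ t → trans (adj-index (a i) (b (neighbour i t))) (a-sees-neighbour i t))

    2≤p : 2 ≤ p
    2≤p = ≤-trans (s≤s (s≤s z≤n)) 4≤p

    c-sees-b : ∀ d k j → toℕ j ≡ cShift d → adjacent (c k) (b j) ≡ true
    c-sees-b d k j j≡shift = adjacent-via d {c k} {b j} (Equivalence.from congruent?⇔ (cong (_% p) j≡shift))

    c-sees-neighbour : ∀ k t → adjacent (c k) (b (inject≤ t 2≤p)) ≡ true
    c-sees-neighbour k t@zero       = c-sees-b vertical   k _ (Finₚ.toℕ-inject≤ t 2≤p)
    c-sees-neighbour k t@(suc zero) = c-sees-b horizontal k _ (Finₚ.toℕ-inject≤ t 2≤p)

    degree-c : ∀ k → 2 ≤ degree G (index (c k))
    degree-c k = injection⇒≤∑b2n (adj G (index (c k))) (λ t → index (b (inject≤ t 2≤p)))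
      (Finₚ.inject≤-injective 2≤p 2≤p _ _ ∘ b-injective ∘ index-injective)
      (λ t → trans (adj-index (c k) (b (inject≤ t 2≤p))) (c-sees-neighbour k t))

    uncoloured-independent : ∀ i j → not (colour (vertex i)) ≡ true → not (colour (vertex j)) ≡ true → adj G i j ≡ false
    uncoloured-independent i j ¬ci ¬cj with adj G i j in i~j
    ... | true  = ⊥-elim (adjacent-colour (vertex i) (vertex j) i~j (trans (not-true ¬ci) (sym (not-true ¬cj))))
      where
      not-true : ∀ {x} → not x ≡ true → x ≡ false
      not-true {false} _ = refl
    ... | false = refl

    2N≤numEdges : 2 * N ≤ numEdges G
    2N≤numEdges = begin
      2 * N
        ≡⟨ solve 2 (λ p e → con 2 :* (p :+ (p :+ e)) := p :* con 4 :+ e :* con 2) refl p e ⟩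
      p * 4 + e * 2
        ≡⟨ cong₂ _+_ (∑-const p 4) (∑-const e 2) ⟨
      ∑[ i < p ] 4 + ∑[ k < e ] 2
        ≤⟨ +-mono-≤ (∑-mono-≤ (≤1* ∘ degree-a)) (∑-mono-≤ (≤1* ∘ degree-c)) ⟩
      ∑[ i < p ] F (a i) + ∑[ k < e ] F (c k)
        ≤⟨ +-monoʳ-≤ (∑[ i < p ] F (a i)) (m≤n+m _ _) ⟩
      ∑[ i < p ] F (a i) + (∑[ j < p ] F (b j) + ∑[ k < e ] F (c k))
        ≡⟨ ∑-vertices F ⟨
      ∑[ u < N ] F (vertex u)
        ≡⟨ sum-cong-≗ (λ u → cong (λ v → b2n (not (colour (vertex u))) * degree G v) (index-vertex u)) ⟩
      ∑[ u < N ] (b2n (not (colour (vertex u))) * degree G u)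
        ≤⟨ ∑-degree-independent≤numEdges G (not ∘ colour ∘ vertex) uncoloured-independent ⟩
      numEdges G
        ∎
      where
      open ≤-Reasoning
      open import Data.Nat.Solver using (module +-*-Solver)
      open +-*-Solver
      F : Vertex → ℕ
      F v = b2n (not (colour v)) * degree G (index v)
      ≤1* : ∀ {m d} → m ≤ d → m ≤ 1 * d
      ≤1* {d = d} m≤d = ≤-trans m≤d (≤-reflexive (sym (*-identityˡ d)))

    numEdges≡2N : numEdges G ≡ 2 * N
    numEdges≡2N = ≤-antisym (numEdges≤2n G (colour ∘ vertex) (proj₂ bipartite) (rect ∘ vertex) visible) 2N≤numEdges

open import Defs hiding (sym)
open import Data.Nat using (ℕ; _≤_; _*_; _+_; _/_; _%_; s≤s⁻¹)
open import Data.Nat.DivMod using (m≡m%n+[m/n]*n; m%n<n; /-monoˡ-≤)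
open import Data.Nat.Solver using (module +-*-Solver)
open import Data.Product using (_×_; Σ; _,_)
open import Relation.Binary.PropositionalEquality using (_≡_; refl; subst; sym; trans)
open +-*-Solver

ExtremalGraph : ℕ → Set
ExtremalGraph n = Σ (Graph n) λ G → IsBipartite G × IsTRVG G × numEdges G ≡ 2 * n

extremalGraph : ∀ p e → 4 ≤ p → e ≤ 1 → ExtremalGraph (p + (p + e))
extremalGraph p e 4≤p e≤1 = G , bipartite , trvg , numEdges≡2N
  where open Extremal.Construction p 4≤p e e≤1

halves : ∀ n → n / 2 + (n / 2 + n % 2) ≡ n
halves n = trans (solve 2 (λ q r → q :+ (q :+ r) := r :+ q :* con 2) refl (n / 2) (n % 2)) (sym (m≡m%n+[m/n]*n n 2))

bipartite-TRVG⇒numEdges≤2n : (n : ℕ) (G : Graph n) → IsBipartite G → IsTRVG G → numEdges G ≤ 2 * n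
bipartite-TRVG⇒numEdges≤2n n G (colour , bipartite) (_ , _ , _ , _ , R , _ , visible) =
  UpperBound.numEdges≤2n G colour bipartite R visible

extremal-exists : (n : ℕ) → 8 ≤ n → ExtremalGraph n
extremal-exists n 8≤n =
  subst ExtremalGraph (halves n) (extremalGraph (n / 2) (n % 2) (/-monoˡ-≤ 2 8≤n) (s≤s⁻¹ (m%n<n n 2)))

theorem1p4 : ((n : ℕ) (G : Graph n) → IsBipartite G → IsTRVG G → numEdges G ≤ 2 * n)
           × ((n : ℕ) → 8 ≤ n →
                Σ (Graph n) λ G → IsBipartite G × IsTRVG G × numEdges G ≡ 2 * n)
theorem1p4 = bipartite-TRVG⇒numEdges≤2n , extremal-exists
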